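{- Let $K=\mathbb{Q}$ and $S=\{|\cdot|_\infty,|\cdot|_2\}$, so that $R_S=\mathbb{Z}[1/2]$. There exist infinitely many ideals $\mathfrak{I}$ of $R_S$ such that there exists a $3$-cycle $(P_0,P_1,P_2)$ in $\mathbb{P}_1(\mathbb{Q})$, for a suitable rational map of degree $4$ defined over $\mathbb{Q}$ with good reduction outside $S$, for which $\mathfrak{I}(P_0,P_1)=\mathfrak{I}$.
   Context: For a prime $p$, a rational map $\Phi([x:y])=[F(x,y):G(x,y)]$ with $F,G\in\mathbb Q[x,y]$ homogeneous of the same degree without common factor has good reduction at $p$ if, after scaling so that $F,G$ have $p$-integral coefficients with at least one a $p$-adic unit, the reductions modulo $p$ have no common zero in $\mathbb P_1(\overline{\mathbb F_p})$; good reduction outside $S$ means good reduction at every odd prime. A $3$-cycle for $\Phi$ is an ordered triple of distinct points $(P_0,P_1,P_2)$ with $\Phi(P_0)=P_1,\Phi(P_1)=P_2,\Phi(P_2)=P_0$. For $P=[x_1:y_1],Q=[x_2:y_2]$, $\delta_p(P,Q)=v_p(x_1y_2-x_2y_1)-\min\{v_p(x_1),v_p(y_1)\}-\min\{v_p(x_2),v_p(y_2)\}$ and $\mathfrak I(P,Q)=\prod_{p\ne 2}p^{\delta_p(P,Q)}\cdot\mathbb Z[1/2]$. -}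

module Defs where

open import Level using (0ℓ)
open import Data.Nat as ℕ using (ℕ; zero; suc)
open import Data.Nat.Primality using (Prime)
open import Data.Integer as ℤ using (ℤ; +_; -[1+_])
open import Data.Integer.Divisibility using () renaming (_∣_ to _∣ℤ_)
open import Data.Rational as ℚ using (ℚ)
open import Data.List as List using (List; []; _∷_; foldl; length)
open import Data.Vec as Vec using (Vec; []; _∷_)
open import Data.Fin using (Fin)
open import Data.Product using (Σ; ∃; _×_; _,_)
open import Data.Sum using (_⊎_)
open import Relation.Nullary using (¬_)
open import Relation.Binary.PropositionalEquality using (_≡_; _≢_)
open import Algebra.Bundles using (CommutativeRing)

record Field : Set₁ where
  field
    commRing : CommutativeRing 0ℓ 0ℓ
  open CommutativeRing commRing public
  field
    1≉0     : ¬ (1# ≈ 0#)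
    inverse : ∀ x → ¬ (x ≈ 0#) → ∃ λ y → (x * y) ≈ 1#

module _ (L : Field) where
  open Field L

  ιℕ : ℕ → Carrier
  ιℕ zero    = 0#
  ιℕ (suc n) = 1# + ιℕ n

  ι : ℤ → Carrier
  ι (+ n)      = ιℕ n
  ι -[1+ n ]   = - ιℕ (suc n)

  HasChar : ℕ → Set
  HasChar p = ι (+ p) ≈ 0#

  -- value of the monic polynomial x^n + c₁ x^(n-1) + … + cₙ
  -- whose non-leading coefficients are listed as [c₁, …, cₙ]
  evalMonic : List Carrier → Carrier → Carrier
  evalMonic cs x = foldl (λ acc c → (acc * x) + c) 1# cs

  AlgClosed : Set
  AlgClosed = ∀ (c : Carrier) (cs : List Carrier) →
              ∃ λ x → evalMonic (c ∷ cs) x ≈ 0#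

  evalFormL : Vec ℤ 5 → Carrier → Carrier → Carrier
  evalFormL (a₀ ∷ a₁ ∷ a₂ ∷ a₃ ∷ a₄ ∷ []) x y =
    (ι a₀ * (x * (x * (x * x)))) + ((ι a₁ * (x * (x * (x * y))))
    + ((ι a₂ * (x * (x * (y * y)))) + ((ι a₃ * (x * (y * (y * y))))
    + (ι a₄ * (y * (y * (y * y)))))))

  CommonZeroIn : Vec ℤ 5 → Vec ℤ 5 → Set
  CommonZeroIn F G = Σ Carrier λ x → Σ Carrier λ y →
    (¬ (x ≈ 0#) ⊎ ¬ (y ≈ 0#)) ×
    (evalFormL F x y ≈ 0#) × (evalFormL G x y ≈ 0#)

Form4 : Set
Form4 = Vec ℤ 5

evalForm : Form4 → ℤ → ℤ → ℤ
evalForm (a₀ ∷ a₁ ∷ a₂ ∷ a₃ ∷ a₄ ∷ []) x y =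
  a₀ ℤ.* (x ℤ.^ 4) ℤ.+ a₁ ℤ.* (x ℤ.^ 3 ℤ.* y) ℤ.+ a₂ ℤ.* (x ℤ.^ 2 ℤ.* y ℤ.^ 2)
  ℤ.+ a₃ ℤ.* (x ℤ.* y ℤ.^ 3) ℤ.+ a₄ ℤ.* (y ℤ.^ 4)

-- Homogeneous forms over ℚ as coefficient lists [c₀, …, c_d]
-- (c₀ x^d + c₁ x^(d-1) y + … + c_d y^d), with their product.

addL : List ℚ → List ℚ → List ℚ
addL []       ys       = ys
addL (x ∷ xs) []       = x ∷ xs
addL (x ∷ xs) (y ∷ ys) = (x ℚ.+ y) ∷ addL xs ys

mulL : List ℚ → List ℚ → List ℚ
mulL []       ys = []
mulL (h ∷ hs) ys = addL (List.map (h ℚ.*_) ys) (ℚ.0ℚ ∷ mulL hs ys)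

toℚList : Form4 → List ℚ
toℚList v = List.map (λ a → a ℚ./ 1) (Vec.toList v)

-- F and G have no common factor in ℚ[x,y]: there is no form H of
-- degree ≥ 1 (length ≥ 2) dividing both.
NoCommonFactor : Form4 → Form4 → Set
NoCommonFactor F G =
  ¬ (Σ (List ℚ) λ H → Σ (List ℚ) λ F′ → Σ (List ℚ) λ G′ →
       (2 ℕ.≤ length H) × (toℚList F ≡ mulL H F′) × (toℚList G ≡ mulL H G′))

-- A rational map Φ = [F : G] of degree 4 over ℚ (coefficients scaled to ℤ):
-- F, G homogeneous of degree 4 without common factor.
record RatMap4 : Set where
  constructor [_∶_]
  field
    F G : Form4

IsDegree4 : RatMap4 → Set
IsDegree4 Φ = NoCommonFactor (RatMap4.F Φ) (RatMap4.G Φ)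

pow : ℕ → ℕ → ℤ
pow p m = + (p ℕ.^ m)

ScaledBy : ℕ → ℕ → Form4 → Form4 → Set
ScaledBy p m F F₀ = F ≡ Vec.map (pow p m ℤ.*_) F₀

SomeUnit : ℕ → Form4 → Form4 → Set
SomeUnit p F₀ G₀ = Σ (Fin 5) λ i →
  (¬ (+ p ∣ℤ Vec.lookup F₀ i)) ⊎ (¬ (+ p ∣ℤ Vec.lookup G₀ i))

-- good reduction at p: after scaling F, G to p-integral coefficients with a
-- p-adic unit among them, the reductions mod p have no common zero in
-- P₁(𝔽̄ₚ)  (𝔽̄ₚ = any algebraically closed field of characteristic p).
GoodReductionAt : ℕ → RatMap4 → Set₁
GoodReductionAt p [ F ∶ G ] =
  Σ ℕ λ m → Σ Form4 λ F₀ → Σ Form4 λ G₀ →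
    ScaledBy p m F F₀ × ScaledBy p m G G₀ × SomeUnit p F₀ G₀ ×
    (∀ (L : Field) → AlgClosed L → HasChar L p → ¬ CommonZeroIn L F₀ G₀)

GoodReductionOutside2 : RatMap4 → Set₁
GoodReductionOutside2 Φ = ∀ (p : ℕ) → Prime p → p ≢ 2 → GoodReductionAt p Φ

-- Points of P₁(ℚ), represented by integer homogeneous coordinates (x , y) ≠ (0 , 0)

record Point : Set where
  constructor ⟨_∶_⟩
  field
    x y : ℤ

NonZeroPt : Point → Set
NonZeroPt ⟨ x ∶ y ⟩ = (x ≢ + 0) ⊎ (y ≢ + 0)

det : Point → Point → ℤ
det ⟨ x₁ ∶ y₁ ⟩ ⟨ x₂ ∶ y₂ ⟩ = x₁ ℤ.* y₂ ℤ.- x₂ ℤ.* y₁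

SamePt : Point → Point → Set
SamePt P Q = det P Q ≡ + 0

MapsTo : RatMap4 → Point → Point → Set
MapsTo [ F ∶ G ] ⟨ x ∶ y ⟩ Q =
  NonZeroPt ⟨ evalForm F x y ∶ evalForm G x y ⟩ × SamePt ⟨ evalForm F x y ∶ evalForm G x y ⟩ Q

IsThreeCycle : RatMap4 → Point → Point → Point → Set
IsThreeCycle Φ P₀ P₁ P₂ =
  NonZeroPt P₀ × NonZeroPt P₁ × NonZeroPt P₂ ×
  ¬ SamePt P₀ P₁ × ¬ SamePt P₁ P₂ × ¬ SamePt P₀ P₂ ×
  MapsTo Φ P₀ P₁ × MapsTo Φ P₁ P₂ × MapsTo Φ P₂ P₀

Val : ℕ → ℤ → ℕ → Set
Val p d k = (pow p k ∣ℤ d) × ¬ (pow p (suc k) ∣ℤ d)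

-- min{v_p(x), v_p(y)} = k   (with v_p(0) = ∞, (x,y) ≠ (0,0))
MinVal : ℕ → Point → ℕ → Set
MinVal p ⟨ x ∶ y ⟩ k =
  (pow p k ∣ℤ x) × (pow p k ∣ℤ y) × ¬ ((pow p (suc k) ∣ℤ x) × (pow p (suc k) ∣ℤ y))

Delta : ℕ → Point → Point → ℕ → Set
Delta p P Q d = ∀ e a b → Val p (det P Q) e → MinVal p P a → MinVal p Q b →
  + e ≡ + d ℤ.+ + a ℤ.+ + b

-- 𝔍(P,Q) = n·ℤ[1/2] for the odd positive integer n: every nonzero ideal of
-- ℤ[1/2] is n·ℤ[1/2] for a unique odd n ≥ 1, and 𝔍(P,Q) = ∏_{p odd} p^{δ_p(P,Q)} ℤ[1/2]
-- equals n·ℤ[1/2] iff v_p(n) = δ_p(P,Q) for all odd primes p.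
IdealIs : ℕ → Point → Point → Set
IdealIs n P Q = ∀ (p : ℕ) → Prime p → p ≢ 2 → ∀ k → Val p (+ n) k → Delta p P Q k

-- With h = 2ᴺ and n = 4h² − 2h + 1, the quartic map Φ = [F : G], whose coefficients are polynomials
-- in h, sends P₀ = [0 : 1] ↦ P₁ = [n : 2h − 1] ↦ P₂ = [n : 2h] ↦ P₀, scaling coordinates by h, −h, h.
-- P₀ and P₁ have coprime coordinates and det(P₀, P₁) = −n, so 𝔍(P₀, P₁) = n·ℤ[1/2], and n is odd.
-- Everything else follows from identities in ℤ[h, x, y], where lᵢ is the linear form vanishing at Pᵢ:
--   x Q = (2h − 1) F − n G,   y (Q + x l₁ l₂) = F − 2h G,   n³ Q = h x³ + l₁ W₁ = −h x³ + l₂ W₂,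
-- with Q(x, 0) = h x³ and Q(0, y) = h y³. In a field in which h ≠ 0 they force every common zero of
-- F and G to be (0, 0), which is good reduction at every prime not dividing h. Over ℚ, put x = 1:
-- a common factor η of F and G divides Q and y·l₁·l₂, which have no common rational root since
-- Q(1, 0) = h and n³ Q = ±h where lᵢ = 0. So η has no rational root, hence is not linear; and if
-- deg η ≥ 2, the cofactor C with η·C = y·l₁·l₂ has degree ≤ 2 yet vanishes at 0, (2h − 1)/n, 2h/n.

module Submission where

open import Defs
open import Data.Nat using (ℕ; _<_)
open import Data.Nat.Divisibility using (_∣_)
open import Data.Product using (Σ; _×_)
open import Relation.Nullary using (¬_)

open import Level using (0ℓ)
open import Function using (id; _∘_)
open import Data.Empty using (⊥; ⊥-elim)
open import Data.Maybe using (Maybe; just; nothing)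
open import Data.Product using (_,_; proj₁; proj₂)
open import Data.Sum as Sum using (_⊎_; inj₁; inj₂; [_,_]′)
open import Relation.Nullary using (yes; no)
open import Relation.Binary.Definitions using (tri<; tri≈; tri>)
open import Relation.Binary.PropositionalEquality as ≡ using (_≡_; _≢_)

import Data.Nat as ℕ
import Data.Nat.Properties as ℕ
open import Data.Nat.Divisibility as ℕD using (_∣?_)
open import Data.Nat.Primality
  using (Prime; prime⇒irreducible; prime[2]; ¬prime[1]; irreducible[2]; euclidsLemma)
open import Data.Nat.Coprimality as ℕ-Coprimality using (Coprime; coprime-Bézout)
open import Data.Nat.GCD using (module Bézout)
open import Data.Nat.Tactic.RingSolver using () renaming (solve-∀ to ℕ-solve-∀)
open import Data.Integer as ℤ using (ℤ; +_; -[1+_]; _⊖_)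
import Data.Integer.Properties as ℤ
open import Data.Integer.GCD using (gcd)
open import Data.Integer.Tactic.RingSolver using () renaming (solve-∀ to ℤ-solve-∀)
open import Data.Rational as ℚ using (ℚ; 0ℚ; 1ℚ)
import Data.Rational.Properties as ℚ
open import Data.Rational.Solver using (module +-*-Solver)
open import Data.List as List using (List; []; _∷_; length)
import Data.List.Properties as Listₚ
open import Data.List.Relation.Unary.All as All using (All; []; _∷_)
open import Data.List.Relation.Unary.AllPairs using ([]; _∷_)
open import Data.List.Relation.Unary.Unique.Propositional using (Unique)
open import Data.Vec as Vec using (Vec; []; _∷_)
import Data.Vec.Properties as Vecₚ
import Data.Fin as Fin

open import Algebra.Bundles using (CommutativeRing)
open import Algebra.Properties.Group ℚ.+-0-group using (x∙y⁻¹≈ε⇒x≈y)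
open import Algebra.Solver.Ring.AlmostCommutativeRing
  using (_-Raw-AlmostCommutative⟶_; fromCommutativeRing; -raw-almostCommutative⟶)
import Algebra.Solver.Ring

prime∤⇒coprime : ∀ {p m} → Prime p → ¬ p ∣ m → Coprime p m
prime∤⇒coprime p-prime p∤m (d∣p , d∣m) with prime⇒irreducible p-prime d∣p
... | inj₁ d≡1    = d≡1
... | inj₂ ≡.refl = ⊥-elim (p∤m d∣m)

prime∤1 : ∀ {p} → Prime p → ¬ p ∣ 1
prime∤1 p-prime p∣1 = ¬prime[1] (≡.subst Prime (ℕD.∣1⇒≡1 p∣1) p-prime)

^-monoʳ-∣ : ∀ p {i j} → i ℕ.≤ j → p ℕ.^ i ∣ p ℕ.^ j
^-monoʳ-∣ p ℕ.z≤n       = ℕD.1∣ _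
^-monoʳ-∣ p (ℕ.s≤s i≤j) = ℕD.*-monoʳ-∣ p (^-monoʳ-∣ p i≤j)

n<2^n : ∀ n → n < 2 ℕ.^ n
n<2^n ℕ.zero    = ℕ.s≤s ℕ.z≤n
n<2^n (ℕ.suc n) = ℕ.+-mono-≤ (ℕ.m^n>0 2 n) (ℕ.≤-trans (n<2^n n) (ℕ.m≤m+n _ 0))

prime∣2^k⇒≡2 : ∀ {p} k → Prime p → p ∣ 2 ℕ.^ k → p ≡ 2
prime∣2^k⇒≡2 ℕ.zero    p-prime p∣1 = ⊥-elim (prime∤1 p-prime p∣1)
prime∣2^k⇒≡2 (ℕ.suc k) p-prime p∣2·2^k with euclidsLemma 2 (2 ℕ.^ k) p-prime p∣2·2^k
... | inj₂ p∣2^k = prime∣2^k⇒≡2 k p-prime p∣2^k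
... | inj₁ p∣2 with irreducible[2] p∣2
...   | inj₁ ≡.refl = ⊥-elim (¬prime[1] p-prime)
...   | inj₂ p≡2    = p≡2

ℤ⟶_ : CommutativeRing 0ℓ 0ℓ → Set
ℤ⟶ R = CommutativeRing.rawRing ℤ.+-*-commutativeRing -Raw-AlmostCommutative⟶ fromCommutativeRing R

module ι-Homomorphism (L : Field) where
  open Field L
  open import Algebra.Properties.Ring ring using (-‿involutive; -‿distribˡ-*; -‿+-comm; -0#≈0#)
  open import Algebra.Properties.Semiring.Mult semiring using (×-homo-+; ×1-homo-*) renaming (_×_ to _×ᴿ_)
  open import Algebra.Properties.CommutativeSemigroup +-commutativeSemigroup using (interchange)
  open import Relation.Binary.Reasoning.Setoid setoid

  ιℕ≡× : ∀ n → ιℕ L n ≡ n ×ᴿ 1#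
  ιℕ≡× ℕ.zero    = ≡.refl
  ιℕ≡× (ℕ.suc n) = ≡.cong (_+_ 1#) (ιℕ≡× n)

  ιℕ-+ : ∀ m n → ιℕ L (m ℕ.+ n) ≈ ιℕ L m + ιℕ L n
  ιℕ-+ m n = begin
    ιℕ L (m ℕ.+ n)        ≡⟨ ιℕ≡× (m ℕ.+ n) ⟩
    (m ℕ.+ n) ×ᴿ 1#        ≈⟨ ×-homo-+ 1# m n ⟩
    m ×ᴿ 1# + n ×ᴿ 1#       ≡⟨ ≡.cong₂ _+_ (ιℕ≡× m) (ιℕ≡× n) ⟨
    ιℕ L m + ιℕ L n       ∎

  ιℕ-* : ∀ m n → ιℕ L (m ℕ.* n) ≈ ιℕ L m * ιℕ L n
  ιℕ-* m n = begin
    ιℕ L (m ℕ.* n)        ≡⟨ ιℕ≡× (m ℕ.* n) ⟩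
    (m ℕ.* n) ×ᴿ 1#        ≈⟨ ×1-homo-* m n ⟩
    m ×ᴿ 1# * n ×ᴿ 1#       ≡⟨ ≡.cong₂ _*_ (ιℕ≡× m) (ιℕ≡× n) ⟨
    ιℕ L m * ιℕ L n       ∎

  ι-neg : ∀ i → ι L (ℤ.- i) ≈ - ι L i
  ι-neg -[1+ n ]       = sym (-‿involutive _)
  ι-neg (+ ℕ.zero)     = sym -0#≈0#
  ι-neg (+ ℕ.suc n)    = refl

  ι-⊖ : ∀ m n → ι L (m ⊖ n) ≈ ιℕ L m - ιℕ L n
  ι-⊖ m         ℕ.zero    = sym (trans (+-congˡ -0#≈0#) (+-identityʳ _))
  ι-⊖ ℕ.zero    (ℕ.suc n) = sym (+-identityˡ _)
  ι-⊖ (ℕ.suc m) (ℕ.suc n) = begin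
    ι L (ℕ.suc m ⊖ ℕ.suc n)              ≡⟨ ≡.cong (ι L) (ℤ.[1+m]⊖[1+n]≡m⊖n m n) ⟩
    ι L (m ⊖ n)                          ≈⟨ ι-⊖ m n ⟩
    ιℕ L m - ιℕ L n                      ≈⟨ +-identityˡ _ ⟨
    0# + (ιℕ L m - ιℕ L n)               ≈⟨ +-congʳ (-‿inverseʳ 1#) ⟨
    (1# - 1#) + (ιℕ L m - ιℕ L n)        ≈⟨ interchange 1# (- 1#) (ιℕ L m) (- ιℕ L n) ⟩
    (1# + ιℕ L m) + (- 1# - ιℕ L n)      ≈⟨ +-congˡ (-‿+-comm 1# (ιℕ L n)) ⟩
    (1# + ιℕ L m) - (1# + ιℕ L n)        ∎

  ι-+ : ∀ i j → ι L (i ℤ.+ j) ≈ ι L i + ι L j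
  ι-+ (+ m)    (+ n)    = ιℕ-+ m n
  ι-+ (+ m)    -[1+ n ] = ι-⊖ m (ℕ.suc n)
  ι-+ -[1+ m ] (+ n)    = trans (ι-⊖ n (ℕ.suc m)) (+-comm _ _)
  ι-+ -[1+ m ] -[1+ n ] = begin
    - ιℕ L (ℕ.suc (ℕ.suc (m ℕ.+ n)))           ≡⟨ ≡.cong (λ k → - ιℕ L (ℕ.suc k)) (ℕ.+-suc m n) ⟨
    - ιℕ L (ℕ.suc m ℕ.+ ℕ.suc n)               ≈⟨ -‿cong (ιℕ-+ (ℕ.suc m) (ℕ.suc n)) ⟩
    - (ιℕ L (ℕ.suc m) + ιℕ L (ℕ.suc n))        ≈⟨ -‿+-comm _ _ ⟨
    - ιℕ L (ℕ.suc m) - ιℕ L (ℕ.suc n)          ∎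

  ι-*ℕ : ∀ m j → ι L (+ m ℤ.* j) ≈ ιℕ L m * ι L j
  ι-*ℕ ℕ.zero    j = sym (zeroˡ _)
  ι-*ℕ (ℕ.suc m) j = begin
    ι L (+ ℕ.suc m ℤ.* j)          ≡⟨ ≡.cong (ι L) (ℤ.suc-* (+ m) j) ⟩
    ι L (j ℤ.+ + m ℤ.* j)          ≈⟨ ι-+ j (+ m ℤ.* j) ⟩
    ι L j + ι L (+ m ℤ.* j)        ≈⟨ +-cong (sym (*-identityˡ _)) (ι-*ℕ m j) ⟩
    1# * ι L j + ιℕ L m * ι L j    ≈⟨ distribʳ _ _ _ ⟨
    (1# + ιℕ L m) * ι L j          ∎

  ι-* : ∀ i j → ι L (i ℤ.* j) ≈ ι L i * ι L j
  ι-* (+ m)    j = ι-*ℕ m j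
  ι-* -[1+ m ] j = begin
    ι L (-[1+ m ] ℤ.* j)             ≡⟨ ≡.cong (ι L) (ℤ.neg-distribˡ-* (+ ℕ.suc m) j) ⟨
    ι L (ℤ.- (+ ℕ.suc m ℤ.* j))      ≈⟨ ι-neg (+ ℕ.suc m ℤ.* j) ⟩
    - ι L (+ ℕ.suc m ℤ.* j)          ≈⟨ -‿cong (ι-*ℕ (ℕ.suc m) j) ⟩
    - (ιℕ L (ℕ.suc m) * ι L j)       ≈⟨ -‿distribˡ-* _ _ ⟩
    - ιℕ L (ℕ.suc m) * ι L j         ∎

  private
    1+ck≡dj⇒⊥ : ∀ c k d j → ιℕ L k ≈ 0# → ιℕ L j ≈ 0# → ℕ.suc (c ℕ.* k) ≡ d ℕ.* j → ⊥
    1+ck≡dj⇒⊥ c k d j k≈0 j≈0 eq = 1≉0 (begin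
      1#                            ≈⟨ +-identityʳ 1# ⟨
      1# + 0#                       ≈⟨ +-congˡ (trans (*-congˡ k≈0) (zeroʳ _)) ⟨
      1# + ιℕ L c * ιℕ L k          ≈⟨ +-congˡ (ιℕ-* c k) ⟨
      ιℕ L (ℕ.suc (c ℕ.* k))        ≡⟨ ≡.cong (ιℕ L) eq ⟩
      ιℕ L (d ℕ.* j)                ≈⟨ ιℕ-* d j ⟩
      ιℕ L d * ιℕ L j               ≈⟨ trans (*-congˡ j≈0) (zeroʳ _) ⟩
      0#                            ∎)

  ιℕ≈0⇒∣ : ∀ {p m} → Prime p → HasChar L p → ιℕ L m ≈ 0# → p ∣ m
  ιℕ≈0⇒∣ {p} {m} p-prime p≈0 m≈0 with p ∣? m
  ... | yes p∣m = p∣m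
  ... | no  p∤m with coprime-Bézout (prime∤⇒coprime p-prime p∤m)
  ...   | Bézout.+- c d 1+dm≡cp = ⊥-elim (1+ck≡dj⇒⊥ d m c p m≈0 p≈0 1+dm≡cp)
  ...   | Bézout.-+ c d 1+cp≡dm = ⊥-elim (1+ck≡dj⇒⊥ c p d m p≈0 m≈0 1+cp≡dm)

  ι-morphism : ℤ⟶ commRing
  ι-morphism = record
    { ⟦_⟧ = ι L ; +-homo = ι-+ ; *-homo = ι-* ; -‿homo = ι-neg
    ; 0-homo = refl ; 1-homo = +-identityʳ 1# }

module FieldProperties (L : Field) where
  open Field L
  open import Relation.Binary.Reasoning.Setoid setoid

  x*y≈0⇒y≈0 : ∀ {x y} → x ≉ 0# → x * y ≈ 0# → y ≈ 0#
  x*y≈0⇒y≈0 {x} {y} x≉0 xy≈0 with inverse x x≉0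
  ... | x⁻¹ , xx⁻¹≈1 = begin
    y                ≈⟨ *-identityˡ y ⟨
    1# * y           ≈⟨ *-congʳ (trans (sym xx⁻¹≈1) (*-comm x x⁻¹)) ⟩
    (x⁻¹ * x) * y    ≈⟨ *-assoc x⁻¹ x y ⟩
    x⁻¹ * (x * y)    ≈⟨ *-congˡ xy≈0 ⟩
    x⁻¹ * 0#         ≈⟨ zeroʳ x⁻¹ ⟩
    0#               ∎

  *-≉0 : ∀ {x y} → x ≉ 0# → y ≉ 0# → x * y ≉ 0#
  *-≉0 x≉0 y≉0 xy≈0 = y≉0 (x*y≈0⇒y≈0 x≉0 xy≈0)


open +-*-Solver using (solve; _:+_; _:*_; _:-_; :-_; _:=_; con)

ℚ-field : Field
ℚ-field = record
  { commRing = ℚ.+-*-commutativeRing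
  ; 1≉0      = λ ()
  ; inverse  = λ p p≢0 → ℚ.1/_ p {{ℚ.≢-nonZero p≢0}} , ℚ.*-inverseʳ p {{ℚ.≢-nonZero p≢0}}
  }

ι-/1 : ∀ z → ι ℚ-field z ≡ z ℚ./ 1
ι-/1 (+ n)      = ιℕ-/1 n
  where
  ιℕ-/1 : ∀ n → ιℕ ℚ-field n ≡ + n ℚ./ 1
  ιℕ-/1 ℕ.zero    = ≡.refl
  ιℕ-/1 (ℕ.suc n) = begin
    1ℚ ℚ.+ ιℕ ℚ-field n          ≡⟨ ≡.cong (1ℚ ℚ.+_) (ιℕ-/1 n) ⟩
    1ℚ ℚ.+ + n ℚ./ 1             ≡⟨ ≡.cong (1ℚ ℚ.+_) (ℚ.normalize-coprime n/1-coprime) ⟩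
    1ℚ ℚ.+ ℚ.mkℚ (+ n) 0 (ℕ-Coprimality.recompute n/1-coprime)
                                 ≡⟨ ℚ./-cong (≡.cong (ℤ._+_ (+ 1)) (ℤ.*-identityʳ (+ n))) ≡.refl ⟩
    + ℕ.suc n ℚ./ 1              ∎
    where
    open ≡.≡-Reasoning
    n/1-coprime : Coprime n 1
    n/1-coprime = ℕ-Coprimality.sym (ℕ-Coprimality.1-coprimeTo n)
ι-/1 -[1+ n ] = ≡.cong ℚ.-_ (ι-/1 (+ ℕ.suc n))

ι-ℚ-≢0 : ∀ {z} → z ≢ + 0 → ι ℚ-field z ≢ 0ℚ
ι-ℚ-≢0 {z} z≢0 ιz≡0 = z≢0 (begin
  z                                ≡⟨ ℚ.↥-/ z 1 ⟨
  ℚ.↥ (z ℚ./ 1) ℤ.* gcd z (+ 1)    ≡⟨ ≡.cong (ℤ._* gcd z (+ 1)) (ℚ.p≡0⇒↥p≡0 _ (≡.trans (≡.sym (ι-/1 z)) ιz≡0)) ⟩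
  + 0                              ∎)
  where open ≡.≡-Reasoning

p*q≡0⇒p≡0∨q≡0 : ∀ {p q} → p ℚ.* q ≡ 0ℚ → p ≡ 0ℚ ⊎ q ≡ 0ℚ
p*q≡0⇒p≡0∨q≡0 {p} pq≡0 with p ℚ.≟ 0ℚ
... | yes p≡0 = inj₁ p≡0
... | no  p≢0 = inj₂ (FieldProperties.x*y≈0⇒y≈0 ℚ-field p≢0 pq≡0)

x≡0⇒x*y≡0 : ∀ y {x} → x ≡ 0ℚ → x ℚ.* y ≡ 0ℚ
x≡0⇒x*y≡0 y ≡.refl = ℚ.*-zeroˡ y

x≡0⇒y*x≡0 : ∀ y {x} → x ≡ 0ℚ → y ℚ.* x ≡ 0ℚ
x≡0⇒y*x≡0 y ≡.refl = ℚ.*-zeroʳ y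

c+0·w≡c : ∀ c w → c ℚ.+ 0ℚ ℚ.* w ≡ c
c+0·w≡c c w = ≡.trans (≡.cong (c ℚ.+_) (ℚ.*-zeroˡ w)) (ℚ.+-identityʳ c)

-- The values at (1 , t) and at (0 , 1) of the binary form with coefficient list L (see Defs).
eval : List ℚ → ℚ → ℚ
eval []       t = 0ℚ
eval (c ∷ cs) t = c ℚ.+ t ℚ.* eval cs t

lastCoeff : List ℚ → ℚ
lastCoeff []           = 0ℚ
lastCoeff (c ∷ [])     = c
lastCoeff (_ ∷ c ∷ cs) = lastCoeff (c ∷ cs)

eval-addL : ∀ U V t → eval (addL U V) t ≡ eval U t ℚ.+ eval V t
eval-addL []       V        t = ≡.sym (ℚ.+-identityˡ _)
eval-addL (u ∷ U)  []       t = ≡.sym (ℚ.+-identityʳ _)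
eval-addL (u ∷ U)  (w ∷ W)  t = ≡.trans (≡.cong (λ s → (u ℚ.+ w) ℚ.+ t ℚ.* s) (eval-addL U W t))
                                        (regroup u w t (eval U t) (eval W t))
  where
  regroup : ∀ u w t p q → (u ℚ.+ w) ℚ.+ t ℚ.* (p ℚ.+ q) ≡ (u ℚ.+ t ℚ.* p) ℚ.+ (w ℚ.+ t ℚ.* q)
  regroup = solve 5 (λ u w t p q → (u :+ w) :+ t :* (p :+ q) := (u :+ t :* p) :+ (w :+ t :* q)) ≡.refl

eval-scale : ∀ c U t → eval (List.map (c ℚ.*_) U) t ≡ c ℚ.* eval U t
eval-scale c []      t = ≡.sym (ℚ.*-zeroʳ c)
eval-scale c (u ∷ U) t = ≡.trans (≡.cong (λ s → c ℚ.* u ℚ.+ t ℚ.* s) (eval-scale c U t))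
                                 (regroup c u t (eval U t))
  where
  regroup : ∀ c u t p → c ℚ.* u ℚ.+ t ℚ.* (c ℚ.* p) ≡ c ℚ.* (u ℚ.+ t ℚ.* p)
  regroup = solve 4 (λ c u t p → c :* u :+ t :* (c :* p) := c :* (u :+ t :* p)) ≡.refl

eval-mulL : ∀ U V t → eval (mulL U V) t ≡ eval U t ℚ.* eval V t
eval-mulL []      V t = ≡.sym (ℚ.*-zeroˡ (eval V t))
eval-mulL (u ∷ U) V t = begin
  eval (addL (List.map (u ℚ.*_) V) (0ℚ ∷ mulL U V)) t
    ≡⟨ eval-addL (List.map (u ℚ.*_) V) _ t ⟩
  eval (List.map (u ℚ.*_) V) t ℚ.+ (0ℚ ℚ.+ t ℚ.* eval (mulL U V) t)
    ≡⟨ ≡.cong₂ (λ p q → p ℚ.+ (0ℚ ℚ.+ t ℚ.* q)) (eval-scale u V t) (eval-mulL U V t) ⟩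
  u ℚ.* eval V t ℚ.+ (0ℚ ℚ.+ t ℚ.* (eval U t ℚ.* eval V t))
    ≡⟨ regroup u t (eval U t) (eval V t) ⟩
  (u ℚ.+ t ℚ.* eval U t) ℚ.* eval V t ∎
  where
  open ≡.≡-Reasoning
  regroup : ∀ u t p q → u ℚ.* q ℚ.+ (0ℚ ℚ.+ t ℚ.* (p ℚ.* q)) ≡ (u ℚ.+ t ℚ.* p) ℚ.* q
  regroup = solve 4 (λ u t p q → u :* q :+ (con 0ℚ :+ t :* (p :* q)) := (u :+ t :* p) :* q) ≡.refl

length-addL : ∀ U V → length (addL U V) ≡ length U ℕ.⊔ length V
length-addL []      V       = ≡.refl
length-addL (u ∷ U) []      = ≡.refl
length-addL (u ∷ U) (w ∷ W) = ≡.cong ℕ.suc (length-addL U W)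

lastCoeff-scale : ∀ c U → lastCoeff (List.map (c ℚ.*_) U) ≡ c ℚ.* lastCoeff U
lastCoeff-scale c []          = ≡.sym (ℚ.*-zeroʳ c)
lastCoeff-scale c (u ∷ [])    = ≡.refl
lastCoeff-scale c (u ∷ w ∷ U) = lastCoeff-scale c (w ∷ U)

lastCoeff-addL-≡ : ∀ U V → length U ≡ length V → lastCoeff (addL U V) ≡ lastCoeff U ℚ.+ lastCoeff V
lastCoeff-addL-≡ []           []           _  = ≡.sym (ℚ.+-identityʳ 0ℚ)
lastCoeff-addL-≡ (u ∷ [])     (w ∷ [])     _  = ≡.refl
lastCoeff-addL-≡ (u ∷ u′ ∷ U) (w ∷ w′ ∷ W) eq =
  lastCoeff-addL-≡ (u′ ∷ U) (w′ ∷ W) (ℕ.suc-injective eq)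
lastCoeff-addL-≡ []           (_ ∷ _)      ()
lastCoeff-addL-≡ (_ ∷ _)      []           ()
lastCoeff-addL-≡ (_ ∷ [])     (_ ∷ _ ∷ _)  ()
lastCoeff-addL-≡ (_ ∷ _ ∷ _)  (_ ∷ [])     ()

lastCoeff-addL-< : ∀ U V → length U < length V → lastCoeff (addL U V) ≡ lastCoeff V
lastCoeff-addL-< []           V            _           = ≡.refl
lastCoeff-addL-< (u ∷ [])     (w ∷ w′ ∷ W) _           = ≡.refl
lastCoeff-addL-< (u ∷ u′ ∷ U) (w ∷ w′ ∷ W) (ℕ.s≤s lt)  = lastCoeff-addL-< (u′ ∷ U) (w′ ∷ W) lt
lastCoeff-addL-< (_ ∷ _)      (_ ∷ [])     (ℕ.s≤s ())
lastCoeff-addL-< (_ ∷ _)      []           ()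

length-mulL : ∀ u U w W → length (mulL (u ∷ U) (w ∷ W)) ≡ ℕ.suc (length U ℕ.+ length W)
length-mulL u []       w W = ≡.cong ℕ.suc (≡.trans (length-addL (List.map (u ℚ.*_) W) [])
  (≡.trans (ℕ.⊔-identityʳ _) (Listₚ.length-map (u ℚ.*_) W)))
length-mulL u (u′ ∷ U) w W = ≡.cong ℕ.suc (begin
  length (addL (List.map (u ℚ.*_) W) (mulL (u′ ∷ U) (w ∷ W)))  ≡⟨ length-addL (List.map (u ℚ.*_) W) _ ⟩
  length (List.map (u ℚ.*_) W) ℕ.⊔ length (mulL (u′ ∷ U) (w ∷ W))
    ≡⟨ ≡.cong₂ ℕ._⊔_ (Listₚ.length-map (u ℚ.*_) W) (length-mulL u′ U w W) ⟩
  length W ℕ.⊔ ℕ.suc (length U ℕ.+ length W)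
    ≡⟨ ℕ.m≤n⇒m⊔n≡n (ℕ.≤-trans (ℕ.m≤n+m (length W) (length U)) (ℕ.n≤1+n _)) ⟩
  ℕ.suc (length U ℕ.+ length W) ∎)
  where open ≡.≡-Reasoning

lastCoeff-mulL : ∀ u U w W → lastCoeff (mulL (u ∷ U) (w ∷ W)) ≡ lastCoeff (u ∷ U) ℚ.* lastCoeff (w ∷ W)
lastCoeff-mulL u []       w []       = ℚ.+-identityʳ (u ℚ.* w)
lastCoeff-mulL u []       w (w′ ∷ W) = lastCoeff-scale u (w′ ∷ W)
lastCoeff-mulL u (u′ ∷ U) w W        =
  ≡.trans (lastCoeff-addL-< (List.map (u ℚ.*_) (w ∷ W)) (0ℚ ∷ mulL (u′ ∷ U) (w ∷ W)) shorter)
          (lastCoeff-mulL u′ U w W)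
  where
  shorter : length (List.map (u ℚ.*_) (w ∷ W)) < ℕ.suc (length (mulL (u′ ∷ U) (w ∷ W)))
  shorter rewrite Listₚ.length-map (u ℚ.*_) W | length-mulL u′ U w W =
    ℕ.s≤s (ℕ.s≤s (ℕ.m≤n+m (length W) (length U)))

lastCoeff-mulL-[] : ∀ U → lastCoeff (mulL U []) ≡ 0ℚ
lastCoeff-mulL-[] []           = ≡.refl
lastCoeff-mulL-[] (u ∷ [])     = ≡.refl
lastCoeff-mulL-[] (u ∷ u′ ∷ U) = lastCoeff-mulL-[] (u′ ∷ U)

dropLastZero : ∀ L → lastCoeff L ≡ 0ℚ →
               Σ (List ℚ) λ L′ → length L′ ≡ ℕ.pred (length L) × (∀ t → eval L′ t ≡ eval L t)
dropLastZero []           _      = [] , ≡.refl , λ _ → ≡.refl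
dropLastZero (c ∷ [])     c≡0    = [] , ≡.refl , λ t →
  ≡.sym (≡.trans (≡.cong (ℚ._+ t ℚ.* 0ℚ) c≡0) (≡.trans (ℚ.+-identityˡ _) (ℚ.*-zeroʳ t)))
dropLastZero (c ∷ c′ ∷ C) last≡0 with dropLastZero (c′ ∷ C) last≡0
... | L′ , |L′|≡|C| , L′≗ =
  c ∷ L′ , ≡.cong ℕ.suc |L′|≡|C| , λ t → ≡.cong (λ s → c ℚ.+ t ℚ.* s) (L′≗ t)

deflate : ℚ → List ℚ → List ℚ
deflate r []       = []
deflate r (c ∷ cs) = addL cs (List.map (r ℚ.*_) (deflate r cs))

length-deflate : ∀ r L → length (deflate r L) ≡ ℕ.pred (length L)
length-deflate r []       = ≡.refl
length-deflate r (c ∷ cs) = begin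
  length (addL cs (List.map (r ℚ.*_) (deflate r cs)))   ≡⟨ length-addL cs _ ⟩
  length cs ℕ.⊔ length (List.map (r ℚ.*_) (deflate r cs))
    ≡⟨ ≡.cong (length cs ℕ.⊔_) (≡.trans (Listₚ.length-map (r ℚ.*_) (deflate r cs)) (length-deflate r cs)) ⟩
  length cs ℕ.⊔ ℕ.pred (length cs)                       ≡⟨ ℕ.m≥n⇒m⊔n≡m ℕ.pred[n]≤n ⟩
  length cs                                             ∎
  where open ≡.≡-Reasoning

eval-deflate : ∀ r L t → eval L t ℚ.- eval L r ≡ (t ℚ.- r) ℚ.* eval (deflate r L) t
eval-deflate r []       t = ≡.trans (ℚ.+-inverseʳ 0ℚ) (≡.sym (ℚ.*-zeroʳ (t ℚ.- r)))
eval-deflate r (c ∷ cs) t = begin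
  (c ℚ.+ t ℚ.* p) ℚ.- (c ℚ.+ r ℚ.* pᵣ)         ≡⟨ regroup₁ c t r p pᵣ ⟩
  (t ℚ.- r) ℚ.* p ℚ.+ r ℚ.* (p ℚ.- pᵣ)          ≡⟨ ≡.cong (λ s → (t ℚ.- r) ℚ.* p ℚ.+ r ℚ.* s)
                                                      (eval-deflate r cs t) ⟩
  (t ℚ.- r) ℚ.* p ℚ.+ r ℚ.* ((t ℚ.- r) ℚ.* q)   ≡⟨ regroup₂ t r p q ⟩
  (t ℚ.- r) ℚ.* (p ℚ.+ r ℚ.* q)                 ≡⟨ ≡.cong ((t ℚ.- r) ℚ.*_) (≡.trans
                                                      (≡.cong (p ℚ.+_) (≡.sym (eval-scale r (deflate r cs) t)))
                                                      (≡.sym (eval-addL cs _ t))) ⟩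
  (t ℚ.- r) ℚ.* eval (deflate r (c ∷ cs)) t      ∎
  where
  open ≡.≡-Reasoning
  p = eval cs t
  pᵣ = eval cs r
  q = eval (deflate r cs) t
  regroup₁ : ∀ c t r p pᵣ →
             (c ℚ.+ t ℚ.* p) ℚ.- (c ℚ.+ r ℚ.* pᵣ) ≡ (t ℚ.- r) ℚ.* p ℚ.+ r ℚ.* (p ℚ.- pᵣ)
  regroup₁ = solve 5 (λ c t r p pᵣ → (c :+ t :* p) :- (c :+ r :* pᵣ) := (t :- r) :* p :+ r :* (p :- pᵣ))
                     ≡.refl
  regroup₂ : ∀ t r p q → (t ℚ.- r) ℚ.* p ℚ.+ r ℚ.* ((t ℚ.- r) ℚ.* q) ≡ (t ℚ.- r) ℚ.* (p ℚ.+ r ℚ.* q)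
  regroup₂ = solve 4 (λ t r p q → (t :- r) :* p :+ r :* ((t :- r) :* q) := (t :- r) :* (p :+ r :* q))
                     ≡.refl

vanishes : ∀ L rs → Unique rs → length L ℕ.≤ length rs → All (λ r → eval L r ≡ 0ℚ) rs →
           ∀ t → eval L t ≡ 0ℚ
vanishes []         _        _                  _                 _              t = ≡.refl
vanishes (_ ∷ _)    []       _                  ()                _              t
vanishes L@(c ∷ cs) (r ∷ rs) (r∉rs ∷ rs-unique) (ℕ.s≤s |cs|≤|rs|) (Lr≡0 ∷ Lrs≡0) t = begin
  eval L t                                ≡⟨ ℚ.+-identityʳ _ ⟨
  eval L t ℚ.+ 0ℚ                         ≡⟨ ≡.cong (λ s → eval L t ℚ.- s) Lr≡0 ⟨
  eval L t ℚ.- eval L r                   ≡⟨ eval-deflate r L t ⟩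
  (t ℚ.- r) ℚ.* eval (deflate r L) t      ≡⟨ ≡.cong ((t ℚ.- r) ℚ.*_) (vanishes (deflate r L) rs rs-unique
                                                 (≡.subst (ℕ._≤ length rs) (≡.sym (length-deflate r L)) |cs|≤|rs|)
                                                 (All.zipWith deflate-root (r∉rs , Lrs≡0)) t) ⟩
  (t ℚ.- r) ℚ.* 0ℚ                        ≡⟨ ℚ.*-zeroʳ (t ℚ.- r) ⟩
  0ℚ                                      ∎
  where
  open ≡.≡-Reasoning
  deflate-root : ∀ {s} → r ≢ s × eval L s ≡ 0ℚ → eval (deflate r L) s ≡ 0ℚ
  deflate-root {s} (r≢s , Ls≡0) =
    FieldProperties.x*y≈0⇒y≈0 ℚ-field (λ s-r≡0 → r≢s (≡.sym (x∙y⁻¹≈ε⇒x≈y s r s-r≡0))) (begin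
      (s ℚ.- r) ℚ.* eval (deflate r L) s   ≡⟨ eval-deflate r L s ⟨
      eval L s ℚ.- eval L r                ≡⟨ ≡.cong₂ ℚ._-_ Ls≡0 Lr≡0 ⟩
      0ℚ ℚ.- 0ℚ                            ≡⟨ ℚ.+-inverseʳ 0ℚ ⟩
      0ℚ                                   ∎)

linear-root : ∀ α β → β ≢ 0ℚ → Σ ℚ λ r → eval (α ∷ β ∷ []) r ≡ 0ℚ
linear-root α β β≢0 = r , (begin
  α ℚ.+ r ℚ.* (β ℚ.+ r ℚ.* 0ℚ)     ≡⟨ regroup α β β⁻¹ ⟩
  α ℚ.- α ℚ.* (β ℚ.* β⁻¹)          ≡⟨ ≡.cong (λ s → α ℚ.- α ℚ.* s) (ℚ.*-inverseʳ β {{β≠0}}) ⟩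
  α ℚ.- α ℚ.* 1ℚ                   ≡⟨ ≡.cong (ℚ._-_ α) (ℚ.*-identityʳ α) ⟩
  α ℚ.- α                          ≡⟨ ℚ.+-inverseʳ α ⟩
  0ℚ                               ∎)
  where
  open ≡.≡-Reasoning
  β≠0 = ℚ.≢-nonZero β≢0
  β⁻¹ = ℚ.1/_ β {{β≠0}}
  r = ℚ.- α ℚ.* β⁻¹
  regroup : ∀ α β β⁻¹ →
            α ℚ.+ (ℚ.- α ℚ.* β⁻¹) ℚ.* (β ℚ.+ (ℚ.- α ℚ.* β⁻¹) ℚ.* 0ℚ) ≡ α ℚ.- α ℚ.* (β ℚ.* β⁻¹)
  regroup = solve 3 (λ α β β⁻¹ → α :+ (:- α :* β⁻¹) :* (β :+ (:- α :* β⁻¹) :* con 0ℚ)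
                                 := α :- α :* (β :* β⁻¹)) ≡.refl

eval-toℚList : ∀ F t → eval (toℚList F) t ≡ evalFormL ℚ-field F 1ℚ t
eval-toℚList (a₀ ∷ a₁ ∷ a₂ ∷ a₃ ∷ a₄ ∷ []) t
  rewrite ι-/1 a₀ | ι-/1 a₁ | ι-/1 a₂ | ι-/1 a₃ | ι-/1 a₄ =
    horner (a₀ ℚ./ 1) (a₁ ℚ./ 1) (a₂ ℚ./ 1) (a₃ ℚ./ 1) (a₄ ℚ./ 1) t
  where
  horner : ∀ c₀ c₁ c₂ c₃ c₄ t →
    c₀ ℚ.+ t ℚ.* (c₁ ℚ.+ t ℚ.* (c₂ ℚ.+ t ℚ.* (c₃ ℚ.+ t ℚ.* (c₄ ℚ.+ t ℚ.* 0ℚ))))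
    ≡ c₀ ℚ.* (1ℚ ℚ.* (1ℚ ℚ.* (1ℚ ℚ.* 1ℚ))) ℚ.+ (c₁ ℚ.* (1ℚ ℚ.* (1ℚ ℚ.* (1ℚ ℚ.* t)))
      ℚ.+ (c₂ ℚ.* (1ℚ ℚ.* (1ℚ ℚ.* (t ℚ.* t))) ℚ.+ (c₃ ℚ.* (1ℚ ℚ.* (t ℚ.* (t ℚ.* t)))
      ℚ.+ c₄ ℚ.* (t ℚ.* (t ℚ.* (t ℚ.* t))))))
  horner = solve 6 (λ c₀ c₁ c₂ c₃ c₄ t →
    c₀ :+ t :* (c₁ :+ t :* (c₂ :+ t :* (c₃ :+ t :* (c₄ :+ t :* con 0ℚ))))
    := c₀ :* (con 1ℚ :* (con 1ℚ :* (con 1ℚ :* con 1ℚ))) :+ (c₁ :* (con 1ℚ :* (con 1ℚ :* (con 1ℚ :* t)))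
       :+ (c₂ :* (con 1ℚ :* (con 1ℚ :* (t :* t))) :+ (c₃ :* (con 1ℚ :* (t :* (t :* t)))
       :+ c₄ :* (t :* (t :* (t :* t))))))) ≡.refl

length-toℚList : ∀ F → length (toℚList F) ≡ 5
length-toℚList (_ ∷ _ ∷ _ ∷ _ ∷ _ ∷ []) = ≡.refl

lastCoeff-toℚList : ∀ F → lastCoeff (toℚList F) ≡ ι ℚ-field (Vec.last F)
lastCoeff-toℚList (_ ∷ _ ∷ _ ∷ _ ∷ a₄ ∷ []) = ≡.sym (ι-/1 a₄)

mapsTo-scaled : ∀ {F G x y x′ y′} c → c ≢ + 0 → NonZeroPt ⟨ x′ ∶ y′ ⟩ →
                evalForm F x y ≡ c ℤ.* x′ → evalForm G x y ≡ c ℤ.* y′ →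
                MapsTo [ F ∶ G ] ⟨ x ∶ y ⟩ ⟨ x′ ∶ y′ ⟩
mapsTo-scaled {x′ = x′} {y′} c c≢0 Q≢0 F≡cx′ G≡cy′ rewrite F≡cx′ | G≡cy′ =
  Sum.map (*-≢0 c≢0) (*-≢0 c≢0) Q≢0 , scaled-det c x′ y′
  where
  *-≢0 : ∀ {i j} → i ≢ + 0 → j ≢ + 0 → i ℤ.* j ≢ + 0
  *-≢0 {i} i≢0 j≢0 ij≡0 = [ i≢0 , j≢0 ]′ (ℤ.i*j≡0⇒i≡0∨j≡0 i ij≡0)

  scaled-det : ∀ c x y → c ℤ.* x ℤ.* y ℤ.- x ℤ.* (c ℤ.* y) ≡ + 0
  scaled-det = ℤ-solve-∀

det-[0:1] : ∀ x y → det ⟨ + 0 ∶ + 1 ⟩ ⟨ x ∶ y ⟩ ≡ ℤ.- x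
det-[0:1] x y = ≡.trans (≡.cong (λ z → + 0 ℤ.- z) (ℤ.*-identityʳ x)) (ℤ.+-identityˡ (ℤ.- x))

Val-unique : ∀ {p z e k} → Val p z e → Val p z k → e ≡ k
Val-unique {p} {e = e} {k} (pᵉ∣z , pᵉ⁺¹∤z) (pᵏ∣z , pᵏ⁺¹∤z) with ℕ.<-cmp e k
... | tri< e<k _ _ = ⊥-elim (pᵉ⁺¹∤z (ℕD.∣-trans (^-monoʳ-∣ p e<k) pᵏ∣z))
... | tri≈ _ e≡k _ = e≡k
... | tri> _ _ k<e = ⊥-elim (pᵏ⁺¹∤z (ℕD.∣-trans (^-monoʳ-∣ p k<e) pᵉ∣z))

Primitive : ℕ → Point → Set
Primitive p ⟨ x ∶ y ⟩ = ¬ (p ∣ ℤ.∣ x ∣ × p ∣ ℤ.∣ y ∣)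

MinVal-primitive : ∀ {p x y k} → Primitive p ⟨ x ∶ y ⟩ → MinVal p ⟨ x ∶ y ⟩ k → k ≡ 0
MinVal-primitive {k = ℕ.zero}  _    _                         = ≡.refl
MinVal-primitive {k = ℕ.suc k} prim (pᵏ⁺¹∣x , pᵏ⁺¹∣y , _) =
  ⊥-elim (prim (ℕD.∣-trans (ℕD.m∣m*n _) pᵏ⁺¹∣x , ℕD.∣-trans (ℕD.m∣m*n _) pᵏ⁺¹∣y))

IdealIs-primitive : ∀ {n P Q} → (∀ p → Prime p → Primitive p P) → (∀ p → Prime p → Primitive p Q) →
                    ℤ.∣ det P Q ∣ ≡ n → IdealIs n P Q
IdealIs-primitive {n} {⟨ x₁ ∶ y₁ ⟩} {⟨ x₂ ∶ y₂ ⟩} P-prim Q-prim ∣det∣≡n p p-prime _ k vₖ e a b vₑ mᵃ mᵇ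
  with MinVal-primitive {x = x₁} {y₁} {a} (P-prim p p-prime) mᵃ
     | MinVal-primitive {x = x₂} {y₂} {b} (Q-prim p p-prime) mᵇ
     | Val-unique {p} {+ n} {e} {k} (≡.subst (λ m → Val p (+ m) e) ∣det∣≡n vₑ) vₖ
... | ≡.refl | ≡.refl | ≡.refl = ≡.cong +_ (≡.sym (≡.trans (ℕ.+-identityʳ _) (ℕ.+-identityʳ e)))

map-*-identityˡ : ∀ {m} (w : Vec ℤ m) → w ≡ Vec.map (ℤ._*_ (+ 1)) w
map-*-identityˡ w = ≡.sym (≡.trans (Vecₚ.map-cong ℤ.*-identityˡ w) (Vecₚ.map-id w))

infixl 6 _⊕_
infixl 7 _⊗_
infix  8 ⊝_
infixr 9 _^ᵉ_

data Ex : Set where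
  𝐡 𝐱 𝐲    : Ex
  con      : ℤ → Ex
  _⊕_ _⊗_  : Ex → Ex → Ex
  ⊝_       : Ex → Ex

_^ᵉ_ : Ex → ℕ → Ex
e ^ᵉ ℕ.zero  = con (+ 1)
e ^ᵉ ℕ.suc k = e ⊗ e ^ᵉ k

inH : List ℤ → Ex
inH []       = con (+ 0)
inH (c ∷ cs) = con c ⊕ 𝐡 ⊗ inH cs

-- The same quartic form, bracketed as in Defs.evalForm and in Defs.evalFormL respectively, so that
-- evaluating it agrees definitionally with those.
form formL : Vec (List ℤ) 5 → Ex → Ex → Ex
form (a₀ ∷ a₁ ∷ a₂ ∷ a₃ ∷ a₄ ∷ []) x y =
  inH a₀ ⊗ x ^ᵉ 4 ⊕ inH a₁ ⊗ (x ^ᵉ 3 ⊗ y) ⊕ inH a₂ ⊗ (x ^ᵉ 2 ⊗ y ^ᵉ 2)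
  ⊕ inH a₃ ⊗ (x ⊗ y ^ᵉ 3) ⊕ inH a₄ ⊗ y ^ᵉ 4
formL (a₀ ∷ a₁ ∷ a₂ ∷ a₃ ∷ a₄ ∷ []) x y =
  inH a₀ ⊗ (x ⊗ (x ⊗ (x ⊗ x))) ⊕ (inH a₁ ⊗ (x ⊗ (x ⊗ (x ⊗ y)))
  ⊕ (inH a₂ ⊗ (x ⊗ (x ⊗ (y ⊗ y))) ⊕ (inH a₃ ⊗ (x ⊗ (y ⊗ (y ⊗ y))) ⊕ inH a₄ ⊗ (y ⊗ (y ⊗ (y ⊗ y))))))

module _ where
  open import Agda.Builtin.FromNat using (fromNat)
  open import Agda.Builtin.FromNeg using (fromNeg)
  open import Data.Unit using (tt)
  import Data.Nat.Literals as ℕ-Literals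
  import Data.Integer.Literals as ℤ-Literals
  private instance
    ℕ-number   = ℕ-Literals.number
    ℤ-number   = ℤ-Literals.number
    ℤ-negative = ℤ-Literals.negative

  𝐚 𝐛 𝐧 : Ex
  𝐚 = inH (-1 ∷ 2 ∷ [])
  𝐛 = inH (0 ∷ 2 ∷ [])
  𝐧 = inH (1 ∷ -2 ∷ 4 ∷ [])

  𝔽 𝔾 : Vec (List ℤ) 5
  𝔽 = (0 ∷ 0 ∷ -2 ∷ [])
    ∷ (0 ∷ 1 ∷ 4 ∷ -4 ∷ 16 ∷ [])
    ∷ (0 ∷ -3 ∷ 14 ∷ -48 ∷ 56 ∷ -64 ∷ [])
    ∷ (0 ∷ -2 ∷ 12 ∷ -40 ∷ 80 ∷ -80 ∷ 64 ∷ [])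
    ∷ (0 ∷ 1 ∷ -2 ∷ 4 ∷ [])
    ∷ []
  𝔾 = (0 ∷ -1 ∷ [])
    ∷ (1 ∷ 0 ∷ -2 ∷ 8 ∷ [])
    ∷ (1 ∷ 3 ∷ -16 ∷ 28 ∷ -32 ∷ [])
    ∷ (0 ∷ 1 ∷ -14 ∷ 32 ∷ -40 ∷ 32 ∷ [])
    ∷ (0 ∷ -1 ∷ 2 ∷ [])
    ∷ []

  𝐪₁ 𝐪₂ : Ex
  𝐪₁ = inH (-1 ∷ 1 ∷ -4 ∷ [])
  𝐪₂ = inH (-1 ∷ 2 ∷ -2 ∷ 4 ∷ [])

  -- the quotients of n³Q ∓ h x³ by l₁ and l₂
  𝐖₁ 𝐖₂ : Ex
  𝐖₁ = inH (0 ∷ 0 ∷ 6 ∷ -12 ∷ 32 ∷ -32 ∷ 32 ∷ []) ⊗ 𝐱 ^ᵉ 2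
     ⊕ inH (1 ∷ -5 ∷ 18 ∷ -44 ∷ 80 ∷ -112 ∷ 96 ∷ -64 ∷ []) ⊗ (𝐱 ⊗ 𝐲)
     ⊕ inH (0 ∷ -1 ∷ 4 ∷ -12 ∷ 16 ∷ -16 ∷ []) ⊗ 𝐲 ^ᵉ 2
  𝐖₂ = inH (1 ∷ -3 ∷ 12 ∷ -28 ∷ 48 ∷ -48 ∷ 32 ∷ []) ⊗ 𝐱 ^ᵉ 2
     ⊕ inH (1 ∷ -6 ∷ 20 ∷ -48 ∷ 80 ∷ -112 ∷ 96 ∷ -64 ∷ []) ⊗ (𝐱 ⊗ 𝐲)
     ⊕ inH (0 ∷ -1 ∷ 4 ∷ -12 ∷ 16 ∷ -16 ∷ []) ⊗ 𝐲 ^ᵉ 2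

𝐅 𝐆 : Ex → Ex → Ex
𝐅 = formL 𝔽
𝐆 = formL 𝔾

𝐥₁ 𝐥₂ : Ex → Ex → Ex
𝐥₁ x y = 𝐚 ⊗ x ⊕ ⊝ (𝐧 ⊗ y)
𝐥₂ x y = 𝐛 ⊗ x ⊕ ⊝ (𝐧 ⊗ y)

𝐞 𝐐 𝐑 𝐒 : Ex
𝐞 = 𝐥₁ 𝐱 𝐲 ⊗ 𝐥₂ 𝐱 𝐲
𝐐 = 𝐡 ⊗ 𝐱 ^ᵉ 3 ⊕ 𝐲 ⊗ 𝐒
𝐒 = 𝐪₁ ⊗ 𝐱 ^ᵉ 2 ⊕ 𝐪₂ ⊗ (𝐱 ⊗ 𝐲) ⊕ 𝐡 ⊗ 𝐲 ^ᵉ 2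
𝐑 = 𝐡 ⊗ 𝐱 ^ᵉ 2 ⊕ 𝐪₁ ⊗ (𝐱 ⊗ 𝐲) ⊕ 𝐪₂ ⊗ 𝐲 ^ᵉ 2 ⊕ 𝐞

module Semantics (R : CommutativeRing 0ℓ 0ℓ) (φ : ℤ⟶ R) where
  open CommutativeRing R
  open _-Raw-AlmostCommutative⟶_ φ using () renaming (⟦_⟧ to cast)

  ⟦_⟧ : Ex → Carrier → Carrier → Carrier → Carrier
  ⟦ 𝐡 ⟧     h x y = h
  ⟦ 𝐱 ⟧     h x y = x
  ⟦ 𝐲 ⟧     h x y = y
  ⟦ con c ⟧ h x y = cast c
  ⟦ e ⊕ f ⟧ h x y = ⟦ e ⟧ h x y + ⟦ f ⟧ h x y
  ⟦ e ⊗ f ⟧ h x y = ⟦ e ⟧ h x y * ⟦ f ⟧ h x y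
  ⟦ ⊝ e ⟧   h x y = - ⟦ e ⟧ h x y

  private
    cast-≟ : ∀ i j → Maybe (cast i ≈ cast j)
    cast-≟ i j with i ℤ.≟ j
    ... | yes ≡.refl = just refl
    ... | no _       = nothing

    module Solver =
      Algebra.Solver.Ring (CommutativeRing.rawRing ℤ.+-*-commutativeRing) (fromCommutativeRing R) φ cast-≟

    poly : Ex → Solver.Polynomial 3
    poly 𝐡       = Solver.var Fin.zero
    poly 𝐱       = Solver.var (Fin.suc Fin.zero)
    poly 𝐲       = Solver.var (Fin.suc (Fin.suc Fin.zero))
    poly (con c) = Solver.con c
    poly (e ⊕ f) = poly e Solver.:+ poly f
    poly (e ⊗ f) = poly e Solver.:* poly f
    poly (⊝ e)   = Solver.:- poly e

    poly-correct : ∀ e h x y → Solver.⟦ poly e ⟧ (h ∷ x ∷ y ∷ []) ≈ ⟦ e ⟧ h x y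
    poly-correct 𝐡       h x y = refl
    poly-correct 𝐱       h x y = refl
    poly-correct 𝐲       h x y = refl
    poly-correct (con c) h x y = refl
    poly-correct (e ⊕ f) h x y = +-cong (poly-correct e h x y) (poly-correct f h x y)
    poly-correct (e ⊗ f) h x y = *-cong (poly-correct e h x y) (poly-correct f h x y)
    poly-correct (⊝ e)   h x y = -‿cong (poly-correct e h x y)

  inH-const : ∀ cs {h x y x′ y′} → ⟦ inH cs ⟧ h x y ≈ ⟦ inH cs ⟧ h x′ y′
  inH-const []       = refl
  inH-const (c ∷ cs) = +-congˡ (*-congˡ (inH-const cs))

  infix 4 _≋_
  record _≋_ (l r : Ex) : Set where
    field holds : ∀ h x y → ⟦ l ⟧ h x y ≈ ⟦ r ⟧ h x y
  open _≋_ public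

  byRing : ∀ {l r} → (∀ h x y → let ρ = h ∷ x ∷ y ∷ [] in Solver.⟦ poly l ⟧↓ ρ ≈ Solver.⟦ poly r ⟧↓ ρ) →
           l ≋ r
  byRing {l} {r} normal = record { holds = λ h x y →
    trans (sym (poly-correct l h x y))
      (trans (Solver.prove (h ∷ x ∷ y ∷ []) (poly l) (poly r) (normal h x y)) (poly-correct r h x y)) }

  xQ≋aF-nG : 𝐱 ⊗ 𝐐 ≋ 𝐚 ⊗ 𝐅 𝐱 𝐲 ⊕ ⊝ (𝐧 ⊗ 𝐆 𝐱 𝐲)
  xQ≋aF-nG = byRing λ _ _ _ → refl

  y[Q+xe]≋F-bG : 𝐲 ⊗ (𝐐 ⊕ 𝐱 ⊗ 𝐞) ≋ 𝐅 𝐱 𝐲 ⊕ ⊝ (𝐛 ⊗ 𝐆 𝐱 𝐲)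
  y[Q+xe]≋F-bG = byRing λ _ _ _ → refl

  n³Q≋hx³+l₁W₁ : 𝐧 ^ᵉ 3 ⊗ 𝐐 ≋ 𝐡 ⊗ 𝐱 ^ᵉ 3 ⊕ 𝐥₁ 𝐱 𝐲 ⊗ 𝐖₁
  n³Q≋hx³+l₁W₁ = byRing λ _ _ _ → refl

  n³Q≋-hx³+l₂W₂ : 𝐧 ^ᵉ 3 ⊗ 𝐐 ≋ ⊝ (𝐡 ⊗ 𝐱 ^ᵉ 3) ⊕ 𝐥₂ 𝐱 𝐲 ⊗ 𝐖₂
  n³Q≋-hx³+l₂W₂ = byRing λ _ _ _ → refl

  Q+xe≋hy³+xR : 𝐐 ⊕ 𝐱 ⊗ 𝐞 ≋ 𝐡 ⊗ 𝐲 ^ᵉ 3 ⊕ 𝐱 ⊗ 𝐑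
  Q+xe≋hy³+xR = byRing λ _ _ _ → refl

  F₄≋hn : inH (Vec.last 𝔽) ≋ 𝐡 ⊗ 𝐧
  F₄≋hn = byRing λ _ _ _ → refl

  G₄≋ha : inH (Vec.last 𝔾) ≋ 𝐡 ⊗ 𝐚
  G₄≋ha = byRing λ _ _ _ → refl

  G₀≋-h : inH (Vec.head 𝔾) ≋ ⊝ 𝐡
  G₀≋-h = byRing λ _ _ _ → refl

  l₂≋l₁+x : 𝐥₂ 𝐱 𝐲 ≋ 𝐥₁ 𝐱 𝐲 ⊕ 𝐱
  l₂≋l₁+x = byRing λ _ _ _ → refl

  l₁[1:-1]≋a+n : 𝐥₁ (con (+ 1)) (con -[1+ 0 ]) ≋ 𝐚 ⊕ 𝐧
  l₁[1:-1]≋a+n = byRing λ _ _ _ → refl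

  l₂[1:-1]≋b+n : 𝐥₂ (con (+ 1)) (con -[1+ 0 ]) ≋ 𝐛 ⊕ 𝐧
  l₂[1:-1]≋b+n = byRing λ _ _ _ → refl

  F[0:1]≋hn : form 𝔽 (con (+ 0)) (con (+ 1)) ≋ 𝐡 ⊗ 𝐧
  F[0:1]≋hn = byRing λ _ _ _ → refl

  G[0:1]≋ha : form 𝔾 (con (+ 0)) (con (+ 1)) ≋ 𝐡 ⊗ 𝐚
  G[0:1]≋ha = byRing λ _ _ _ → refl

  F[n:a]≋-hn : form 𝔽 𝐧 𝐚 ≋ ⊝ 𝐡 ⊗ 𝐧
  F[n:a]≋-hn = byRing λ _ _ _ → refl

  G[n:a]≋-hb : form 𝔾 𝐧 𝐚 ≋ ⊝ 𝐡 ⊗ 𝐛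
  G[n:a]≋-hb = byRing λ _ _ _ → refl

  F[n:b]≋0 : form 𝔽 𝐧 𝐛 ≋ 𝐡 ⊗ con (+ 0)
  F[n:b]≋0 = byRing λ _ _ _ → refl

  G[n:b]≋h : form 𝔾 𝐧 𝐛 ≋ 𝐡 ⊗ con (+ 1)
  G[n:b]≋h = byRing λ _ _ _ → refl

  a≋1+2[h-1] : 𝐚 ≋ con (+ 1) ⊕ con (+ 2) ⊗ (𝐡 ⊕ con -[1+ 0 ])
  a≋1+2[h-1] = byRing λ _ _ _ → refl

  b≋1+a : 𝐛 ≋ con (+ 1) ⊕ 𝐚
  b≋1+a = byRing λ _ _ _ → refl

  n≋1+ab : 𝐧 ≋ con (+ 1) ⊕ 𝐚 ⊗ 𝐛
  n≋1+ab = byRing λ _ _ _ → refl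

module ℤˢ = Semantics ℤ.+-*-commutativeRing (-raw-almostCommutative⟶ (fromCommutativeRing ℤ.+-*-commutativeRing))

module InField (L : Field) where
  open Field L
  open ι-Homomorphism L
  open FieldProperties L
  open Semantics commRing ι-morphism public
  open import Algebra.Properties.Ring ring using (-0#≈0#; -‿involutive; -‿distribˡ-*; -‿distribʳ-*)
  open import Algebra.Properties.AbelianGroup +-abelianGroup using (inverseʳ-unique)
  open import Algebra.Properties.CommutativeSemigroup *-commutativeSemigroup
    using (x∙yz≈y∙xz) renaming (interchange to interchange*)
  open import Relation.Binary.Reasoning.Setoid setoid

  ι-⟦⟧ : ∀ e h x y → ι L (ℤˢ.⟦ e ⟧ h x y) ≈ ⟦ e ⟧ (ι L h) (ι L x) (ι L y)
  ι-⟦⟧ 𝐡       h x y = refl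
  ι-⟦⟧ 𝐱       h x y = refl
  ι-⟦⟧ 𝐲       h x y = refl
  ι-⟦⟧ (con c) h x y = refl
  ι-⟦⟧ (e ⊕ f) h x y =
    trans (ι-+ (ℤˢ.⟦ e ⟧ h x y) (ℤˢ.⟦ f ⟧ h x y)) (+-cong (ι-⟦⟧ e h x y) (ι-⟦⟧ f h x y))
  ι-⟦⟧ (e ⊗ f) h x y =
    trans (ι-* (ℤˢ.⟦ e ⟧ h x y) (ℤˢ.⟦ f ⟧ h x y)) (*-cong (ι-⟦⟧ e h x y) (ι-⟦⟧ f h x y))
  ι-⟦⟧ (⊝ e)   h x y = trans (ι-neg (ℤˢ.⟦ e ⟧ h x y)) (-‿cong (ι-⟦⟧ e h x y))

  evalFormL-formL : ∀ h (𝔸 : Vec (List ℤ) 5) x y →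
    evalFormL L (Vec.map (λ cs → ℤˢ.⟦ inH cs ⟧ h (+ 0) (+ 0)) 𝔸) x y ≈ ⟦ formL 𝔸 𝐱 𝐲 ⟧ (ι L h) x y
  evalFormL-formL h (a₀ ∷ a₁ ∷ a₂ ∷ a₃ ∷ a₄ ∷ []) x y =
    +-cong (*-congʳ (coeff a₀)) (+-cong (*-congʳ (coeff a₁)) (+-cong (*-congʳ (coeff a₂))
      (+-cong (*-congʳ (coeff a₃)) (*-congʳ (coeff a₄)))))
    where
    coeff : ∀ cs → ι L (ℤˢ.⟦ inH cs ⟧ h (+ 0) (+ 0)) ≈ ⟦ inH cs ⟧ (ι L h) x y
    coeff cs = trans (ι-⟦⟧ (inH cs) h (+ 0) (+ 0)) (inH-const cs)

  ^ᵉ-≉0 : ∀ {e h x y} k → ⟦ e ⟧ h x y ≉ 0# → ⟦ e ^ᵉ k ⟧ h x y ≉ 0#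
  ^ᵉ-≉0 ℕ.zero    _   1+0≈0 = 1≉0 (trans (sym (+-identityʳ 1#)) 1+0≈0)
  ^ᵉ-≉0 (ℕ.suc k) e≉0 = *-≉0 e≉0 (^ᵉ-≉0 k e≉0)

  private
    p-vq≈0 : ∀ {p v q} → p ≈ 0# → q ≈ 0# → p + - (v * q) ≈ 0#
    p-vq≈0 {p} {v} {q} p≈0 q≈0 = begin
      p + - (v * q)      ≈⟨ +-cong p≈0 (-‿cong (trans (*-congˡ q≈0) (zeroʳ v))) ⟩
      0# + - 0#          ≈⟨ -‿inverseʳ 0# ⟩
      0#                 ∎

  noCommonZero : ∀ {ĥ x y} → ĥ ≉ 0# → x ≉ 0# ⊎ y ≉ 0# →
                 ⟦ 𝐅 𝐱 𝐲 ⟧ ĥ x y ≈ 0# → ⟦ 𝐆 𝐱 𝐲 ⟧ ĥ x y ≈ 0# → ⊥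
  noCommonZero {ĥ} {x} {y} ĥ≉0 x≉0⊎y≉0 F≈0 G≈0 = ĥx³≉0 ĥx³≈0
    where
    E : Ex → Carrier
    E e = ⟦ e ⟧ ĥ x y

    y[Q+xe]≈0 : y * (E 𝐐 + x * E 𝐞) ≈ 0#
    y[Q+xe]≈0 = trans (holds y[Q+xe]≋F-bG ĥ x y) (p-vq≈0 F≈0 G≈0)

    x≉0 : x ≉ 0#
    x≉0 x≈0 = *-≉0 y≉0 (*-≉0 ĥ≉0 (^ᵉ-≉0 {𝐲} {ĥ} {x} {y} 3 y≉0)) (begin
      y * (ĥ * E (𝐲 ^ᵉ 3))                ≈⟨ *-congˡ (+-identityʳ _) ⟨
      y * (ĥ * E (𝐲 ^ᵉ 3) + 0#)           ≈⟨ *-congˡ (+-congˡ (trans (*-congʳ x≈0) (zeroˡ _))) ⟨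
      y * (ĥ * E (𝐲 ^ᵉ 3) + x * E 𝐑)      ≈⟨ *-congˡ (holds Q+xe≋hy³+xR ĥ x y) ⟨
      y * (E 𝐐 + x * E 𝐞)                 ≈⟨ y[Q+xe]≈0 ⟩
      0#                                  ∎)
      where
      y≉0 : y ≉ 0#
      y≉0 = [ (λ x≉0′ → ⊥-elim (x≉0′ x≈0)) , id ]′ x≉0⊎y≉0

    Q≈0 : E 𝐐 ≈ 0#
    Q≈0 = x*y≈0⇒y≈0 x≉0 (trans (holds xQ≋aF-nG ĥ x y) (p-vq≈0 (trans (*-congˡ F≈0) (zeroʳ _)) G≈0))

    ye≈0 : y * E 𝐞 ≈ 0#
    ye≈0 = x*y≈0⇒y≈0 x≉0 (begin
      x * (y * E 𝐞)           ≈⟨ x∙yz≈y∙xz x y (E 𝐞) ⟩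
      y * (x * E 𝐞)           ≈⟨ *-congˡ (+-identityˡ _) ⟨
      y * (0# + x * E 𝐞)      ≈⟨ *-congˡ (+-congʳ Q≈0) ⟨
      y * (E 𝐐 + x * E 𝐞)     ≈⟨ y[Q+xe]≈0 ⟩
      0#                      ∎)

    ĥx³ : Carrier
    ĥx³ = ĥ * E (𝐱 ^ᵉ 3)

    ĥx³≉0 : ĥx³ ≉ 0#
    ĥx³≉0 = *-≉0 ĥ≉0 (^ᵉ-≉0 {𝐱} {ĥ} {x} {y} 3 x≉0)

    n³Q≈0 : E (𝐧 ^ᵉ 3) * E 𝐐 ≈ 0#
    n³Q≈0 = trans (*-congˡ Q≈0) (zeroʳ _)

    l₁W₁≈-ĥx³ : E (𝐥₁ 𝐱 𝐲) * E 𝐖₁ ≈ - ĥx³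
    l₁W₁≈-ĥx³ = inverseʳ-unique ĥx³ _ (trans (sym (holds n³Q≋hx³+l₁W₁ ĥ x y)) n³Q≈0)

    l₂W₂≈ĥx³ : E (𝐥₂ 𝐱 𝐲) * E 𝐖₂ ≈ ĥx³
    l₂W₂≈ĥx³ = trans (inverseʳ-unique (- ĥx³) _ (trans (sym (holds n³Q≋-hx³+l₂W₂ ĥ x y)) n³Q≈0))
                     (-‿involutive ĥx³)

    -- no case split on y ≈ 0# or lᵢ ≈ 0# is available in an abstract field, hence the product y (h x³)²
    y≈0 : y ≈ 0#
    y≈0 = x*y≈0⇒y≈0 (*-≉0 ĥx³≉0 ĥx³≉0) (begin
      ĥx³ * ĥx³ * y                          ≈⟨ *-comm _ y ⟩
      y * (ĥx³ * ĥx³)                        ≈⟨ -‿involutive _ ⟨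
      - - (y * (ĥx³ * ĥx³))                  ≈⟨ -‿cong (-‿distribʳ-* y _) ⟩
      - (y * - (ĥx³ * ĥx³))                  ≈⟨ -‿cong (*-congˡ (-‿distribˡ-* ĥx³ ĥx³)) ⟩
      - (y * (- ĥx³ * ĥx³))                  ≈⟨ -‿cong (*-congˡ (*-cong l₁W₁≈-ĥx³ l₂W₂≈ĥx³)) ⟨
      - (y * ((l₁ * W₁) * (l₂ * W₂)))        ≈⟨ -‿cong (*-congˡ (interchange* l₁ W₁ l₂ W₂)) ⟩
      - (y * ((l₁ * l₂) * (W₁ * W₂)))        ≈⟨ -‿cong (*-assoc y _ _) ⟨
      - (y * (l₁ * l₂) * (W₁ * W₂))          ≈⟨ -‿cong (trans (*-congʳ ye≈0) (zeroˡ _)) ⟩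
      - 0#                                   ≈⟨ -0#≈0# ⟩
      0#                                     ∎)
      where
      l₁ = E (𝐥₁ 𝐱 𝐲)
      l₂ = E (𝐥₂ 𝐱 𝐲)
      W₁ = E 𝐖₁
      W₂ = E 𝐖₂

    ĥx³≈0 : ĥx³ ≈ 0#
    ĥx³≈0 = begin
      ĥx³                    ≈⟨ +-identityʳ ĥx³ ⟨
      ĥx³ + 0#               ≈⟨ +-congˡ (trans (*-congʳ y≈0) (zeroˡ _)) ⟨
      ĥx³ + y * E 𝐒          ≡⟨⟩
      E 𝐐                    ≈⟨ Q≈0 ⟩
      0#                     ∎

module Construction (v : ℕ) where
  open ℤˢ using (_≋_; holds; a≋1+2[h-1]; b≋1+a; n≋1+ab; F[0:1]≋hn; G[0:1]≋ha; F[n:a]≋-hn; G[n:a]≋-hb;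
                 F[n:b]≋0; G[n:b]≋h; G₀≋-h)

  -- h, 2h − 1, 2h and 4h² − 2h + 1
  h a b n : ℕ
  h = ℕ.suc v
  a = ℕ.suc (2 ℕ.* v)
  b = ℕ.suc a
  n = ℕ.suc (a ℕ.* b)

  val : Ex → ℤ
  val e = ℤˢ.⟦ e ⟧ (+ h) (+ 0) (+ 0)

  F G : Form4
  F = Vec.map (val ∘ inH) 𝔽
  G = Vec.map (val ∘ inH) 𝔾

  Φ : RatMap4
  Φ = [ F ∶ G ]

  P₀ P₁ P₂ : Point
  P₀ = ⟨ + 0 ∶ + 1 ⟩
  P₁ = ⟨ + n ∶ + a ⟩
  P₂ = ⟨ + n ∶ + b ⟩

  val-𝐚 : val 𝐚 ≡ + a
  val-𝐚 = ≡.trans (holds a≋1+2[h-1] (+ h) (+ 0) (+ 0)) (≡.cong (ℤ._+_ (+ 1)) (≡.sym (ℤ.pos-* 2 v)))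

  val-𝐛 : val 𝐛 ≡ + b
  val-𝐛 = ≡.trans (holds b≋1+a (+ h) (+ 0) (+ 0)) (≡.cong (ℤ._+_ (+ 1)) val-𝐚)

  val-𝐧 : val 𝐧 ≡ + n
  val-𝐧 = ≡.trans (holds n≋1+ab (+ h) (+ 0) (+ 0))
            (≡.cong (ℤ._+_ (+ 1)) (≡.trans (≡.cong₂ ℤ._*_ val-𝐚 val-𝐛) (≡.sym (ℤ.pos-* a b))))

  evalForm-at : ∀ 𝔸 {x y} ex ey {rhs} → val ex ≡ x → val ey ≡ y → form 𝔸 ex ey ≋ rhs →
                evalForm (Vec.map (val ∘ inH) 𝔸) x y ≡ val rhs
  evalForm-at (_ ∷ _ ∷ _ ∷ _ ∷ _ ∷ []) ex ey ≡.refl ≡.refl image = holds image (+ h) (+ 0) (+ 0)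

  P₀↦P₁ : MapsTo Φ P₀ P₁
  P₀↦P₁ = mapsTo-scaled {F} {G} {+ 0} {+ 1} {+ n} {+ a} (+ h) (λ ()) (inj₁ (λ ()))
    (≡.trans (evalForm-at 𝔽 (con (+ 0)) (con (+ 1)) ≡.refl ≡.refl F[0:1]≋hn) (≡.cong (ℤ._*_ (+ h)) val-𝐧))
    (≡.trans (evalForm-at 𝔾 (con (+ 0)) (con (+ 1)) ≡.refl ≡.refl G[0:1]≋ha) (≡.cong (ℤ._*_ (+ h)) val-𝐚))

  P₁↦P₂ : MapsTo Φ P₁ P₂
  P₁↦P₂ = mapsTo-scaled {F} {G} {+ n} {+ a} {+ n} {+ b} (ℤ.- + h) (λ ()) (inj₁ (λ ()))
    (≡.trans (evalForm-at 𝔽 𝐧 𝐚 val-𝐧 val-𝐚 F[n:a]≋-hn) (≡.cong (ℤ._*_ (ℤ.- + h)) val-𝐧))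
    (≡.trans (evalForm-at 𝔾 𝐧 𝐚 val-𝐧 val-𝐚 G[n:a]≋-hb) (≡.cong (ℤ._*_ (ℤ.- + h)) val-𝐛))

  P₂↦P₀ : MapsTo Φ P₂ P₀
  P₂↦P₀ = mapsTo-scaled {F} {G} {+ n} {+ b} {+ 0} {+ 1} (+ h) (λ ()) (inj₂ (λ ()))
    (evalForm-at 𝔽 𝐧 𝐛 val-𝐧 val-𝐛 F[n:b]≋0)
    (evalForm-at 𝔾 𝐧 𝐛 val-𝐧 val-𝐛 G[n:b]≋h)

  threeCycle : IsThreeCycle Φ P₀ P₁ P₂
  threeCycle = inj₂ (λ ()) , inj₁ (λ ()) , inj₁ (λ ())
             , (λ det≡0 → -n≢0 (≡.trans (≡.sym (det-[0:1] (+ n) (+ a))) det≡0))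
             , (λ det≡0 → n≢0 (≡.trans (≡.sym (n[1+a]-na≡n (+ n) (+ a))) det≡0))
             , (λ det≡0 → -n≢0 (≡.trans (≡.sym (det-[0:1] (+ n) (+ b))) det≡0))
             , P₀↦P₁ , P₁↦P₂ , P₂↦P₀
    where
    n≢0 : + n ≢ + 0
    n≢0 ()
    -n≢0 : ℤ.- + n ≢ + 0
    -n≢0 ()
    n[1+a]-na≡n : ∀ n a → n ℤ.* (+ 1 ℤ.+ a) ℤ.- n ℤ.* a ≡ n
    n[1+a]-na≡n = ℤ-solve-∀

  primitive-P₀ : ∀ p → Prime p → Primitive p P₀
  primitive-P₀ p p-prime (_ , p∣1) = prime∤1 p-prime p∣1

  primitive-P₁ : ∀ p → Prime p → Primitive p P₁
  primitive-P₁ p p-prime (p∣1+ab , p∣a) =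
    prime∤1 p-prime (ℕD.∣m+n∣m⇒∣n (≡.subst (p ∣_) (ℕ.+-comm 1 (a ℕ.* b)) p∣1+ab) (ℕD.∣m⇒∣m*n b p∣a))

  ideal : IdealIs n P₀ P₁
  ideal = IdealIs-primitive {n} {P₀} {P₁} primitive-P₀ primitive-P₁ (≡.cong ℤ.∣_∣ (det-[0:1] (+ n) (+ a)))

  n-odd : ¬ 2 ∣ n
  n-odd 2∣1+ab =
    prime∤1 prime[2] (ℕD.∣m+n∣m⇒∣n (≡.subst (2 ∣_) (ℕ.+-comm 1 (a ℕ.* b)) 2∣1+ab) (ℕD.∣n⇒∣m*n a 2∣b))
    where
    2+2v≡[1+v]2 : ∀ v → ℕ.suc (ℕ.suc (2 ℕ.* v)) ≡ ℕ.suc v ℕ.* 2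
    2+2v≡[1+v]2 = ℕ-solve-∀
    2∣b : 2 ∣ b
    2∣b = ℕD.divides h (2+2v≡[1+v]2 v)

  h<n : h < n
  h<n = ℕ.s≤s (ℕ.≤-trans (ℕ.s≤s (ℕ.≤-trans (ℕ.m≤m+n v _) (ℕ.n≤1+n _))) (ℕ.m≤n*m b a))

  noCommonZeroIn : ∀ L → (let open Field L in ι L (+ h) ≉ 0#) → ¬ CommonZeroIn L F G
  noCommonZeroIn L ĥ≉0 (x , y , nonzero , F≈0 , G≈0) =
    noCommonZero ĥ≉0 nonzero (trans (sym (evalFormL-formL (+ h) 𝔽 x y)) F≈0)
                             (trans (sym (evalFormL-formL (+ h) 𝔾 x y)) G≈0)
    where open InField L
          open Field L using (trans; sym)

  goodReduction : ∀ p → Prime p → ¬ p ∣ h → GoodReductionAt p Φ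
  goodReduction p p-prime p∤h =
    0 , F , G , map-*-identityˡ F , map-*-identityˡ G , (Fin.zero , inj₂ p∤G₀) ,
    λ L _ p≈0 → noCommonZeroIn L (λ h≈0 → p∤h (ι-Homomorphism.ιℕ≈0⇒∣ L p-prime p≈0 h≈0))
    where
    p∤G₀ : ¬ p ∣ ℤ.∣ Vec.head G ∣
    p∤G₀ p∣G₀ = p∤h (≡.subst (p ∣_) (≡.cong ℤ.∣_∣ (holds G₀≋-h (+ h) (+ 0) (+ 0))) p∣G₀)

module Coprimality (v : ℕ) where
  open Construction v
  open FieldProperties ℚ-field using (x*y≈0⇒y≈0; *-≉0)
  open InField ℚ-field
    using (⟦_⟧; holds; ι-⟦⟧; evalFormL-formL; xQ≋aF-nG; y[Q+xe]≋F-bG; n³Q≋hx³+l₁W₁; n³Q≋-hx³+l₂W₂;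
           F₄≋hn; G₄≋ha; l₂≋l₁+x; l₁[1:-1]≋a+n; l₂[1:-1]≋b+n)
  open ≡.≡-Reasoning

  ĥ â b̂ n̂ : ℚ
  ĥ = ι ℚ-field (+ h)
  â = ⟦ 𝐚 ⟧ ĥ 0ℚ 0ℚ
  b̂ = ⟦ 𝐛 ⟧ ĥ 0ℚ 0ℚ
  n̂ = ⟦ 𝐧 ⟧ ĥ 0ℚ 0ℚ

  f g q e l₁ l₂ : ℚ → ℚ
  f t  = ⟦ 𝐅 𝐱 𝐲 ⟧ ĥ 1ℚ t
  g t  = ⟦ 𝐆 𝐱 𝐲 ⟧ ĥ 1ℚ t
  q t  = ⟦ 𝐐 ⟧ ĥ 1ℚ t
  e t  = ⟦ 𝐞 ⟧ ĥ 1ℚ t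
  l₁ t = ⟦ 𝐥₁ 𝐱 𝐲 ⟧ ĥ 1ℚ t
  l₂ t = ⟦ 𝐥₂ 𝐱 𝐲 ⟧ ĥ 1ℚ t

  eval-coefficients : ∀ 𝔸 t →
                      eval (toℚList (Vec.map (val ∘ inH) 𝔸)) t ≡ ⟦ formL 𝔸 𝐱 𝐲 ⟧ ĥ 1ℚ t
  eval-coefficients 𝔸 t = ≡.trans (eval-toℚList (Vec.map (val ∘ inH) 𝔸) t) (evalFormL-formL (+ h) 𝔸 1ℚ t)

  lastCoeff-coefficients : ∀ 𝔸 →
                           lastCoeff (toℚList (Vec.map (val ∘ inH) 𝔸)) ≡ ⟦ inH (Vec.last 𝔸) ⟧ ĥ 0ℚ 0ℚ
  lastCoeff-coefficients 𝔸@(_ ∷ _ ∷ _ ∷ _ ∷ a₄ ∷ []) =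
    ≡.trans (lastCoeff-toℚList (Vec.map (val ∘ inH) 𝔸)) (ι-⟦⟧ (inH a₄) (+ h) (+ 0) (+ 0))

  lastCoeff-F : lastCoeff (toℚList F) ≡ ĥ ℚ.* n̂
  lastCoeff-F = ≡.trans (lastCoeff-coefficients 𝔽) (holds F₄≋hn ĥ 0ℚ 0ℚ)

  lastCoeff-G : lastCoeff (toℚList G) ≡ ĥ ℚ.* â
  lastCoeff-G = ≡.trans (lastCoeff-coefficients 𝔾) (holds G₄≋ha ĥ 0ℚ 0ℚ)

  positive⇒≢0 : ∀ e {k} → val e ≡ + ℕ.suc k → ⟦ e ⟧ ĥ 0ℚ 0ℚ ≢ 0ℚ
  positive⇒≢0 e val≡1+k ⟦e⟧≡0 =
    ι-ℚ-≢0 (λ val≡0 → 1+k≢0 (≡.trans (≡.sym val≡1+k) val≡0))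
           (≡.trans (ι-⟦⟧ e (+ h) (+ 0) (+ 0)) ⟦e⟧≡0)
    where
    1+k≢0 : ∀ {k} → + ℕ.suc k ≢ + 0
    1+k≢0 ()

  ĥ≢0 : ĥ ≢ 0ℚ
  ĥ≢0 = ι-ℚ-≢0 {+ h} (λ ())

  â≢0 : â ≢ 0ℚ
  â≢0 = positive⇒≢0 𝐚 val-𝐚

  n̂≢0 : n̂ ≢ 0ℚ
  n̂≢0 = positive⇒≢0 𝐧 val-𝐧

  af-ng≡q : ∀ t → â ℚ.* f t ℚ.- n̂ ℚ.* g t ≡ q t
  af-ng≡q t = ≡.trans (≡.sym (holds xQ≋aF-nG ĥ 1ℚ t)) (ℚ.*-identityˡ (q t))

  f-bg≡t[q+e] : ∀ t → f t ℚ.- b̂ ℚ.* g t ≡ t ℚ.* (q t ℚ.+ e t)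
  f-bg≡t[q+e] t =
    ≡.trans (≡.sym (holds y[Q+xe]≋F-bG ĥ 1ℚ t)) (≡.cong (λ s → t ℚ.* (q t ℚ.+ s)) (ℚ.*-identityˡ (e t)))

  ĥ·1≢0 : ĥ ℚ.* 1ℚ ≢ 0ℚ
  ĥ·1≢0 = ĥ≢0 ∘ ≡.trans (≡.sym (ℚ.*-identityʳ ĥ))

  q≢0 : ∀ t → t ℚ.* e t ≡ 0ℚ → q t ≢ 0ℚ
  q≢0 t te≡0 q≡0 with p*q≡0⇒p≡0∨q≡0 {t} {e t} te≡0
  ... | inj₁ ≡.refl = ĥ·1≢0 (≡.trans (≡.sym (c+0·w≡c (ĥ ℚ.* 1ℚ) (⟦ 𝐒 ⟧ ĥ 1ℚ 0ℚ))) q≡0)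
  ... | inj₂ e≡0 with p*q≡0⇒p≡0∨q≡0 {l₁ t} {l₂ t} e≡0
  ...   | inj₁ l₁≡0 = ĥ·1≢0 (begin
    ĥ ℚ.* 1ℚ                                  ≡⟨ c+0·w≡c (ĥ ℚ.* 1ℚ) (⟦ 𝐖₁ ⟧ ĥ 1ℚ t) ⟨
    ĥ ℚ.* 1ℚ ℚ.+ 0ℚ ℚ.* ⟦ 𝐖₁ ⟧ ĥ 1ℚ t           ≡⟨ ≡.cong (λ s → ĥ ℚ.* 1ℚ ℚ.+ s ℚ.* ⟦ 𝐖₁ ⟧ ĥ 1ℚ t) l₁≡0 ⟨
    ĥ ℚ.* 1ℚ ℚ.+ l₁ t ℚ.* ⟦ 𝐖₁ ⟧ ĥ 1ℚ t         ≡⟨ holds n³Q≋hx³+l₁W₁ ĥ 1ℚ t ⟨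
    ⟦ 𝐧 ^ᵉ 3 ⟧ ĥ 1ℚ t ℚ.* q t                  ≡⟨ x≡0⇒y*x≡0 (⟦ 𝐧 ^ᵉ 3 ⟧ ĥ 1ℚ t) q≡0 ⟩
    0ℚ                                        ∎)
  ...   | inj₂ l₂≡0 = ĥ·1≢0 (ℚ.neg-injective (begin
    ℚ.- (ĥ ℚ.* 1ℚ)                             ≡⟨ c+0·w≡c (ℚ.- (ĥ ℚ.* 1ℚ)) (⟦ 𝐖₂ ⟧ ĥ 1ℚ t) ⟨
    ℚ.- (ĥ ℚ.* 1ℚ) ℚ.+ 0ℚ ℚ.* ⟦ 𝐖₂ ⟧ ĥ 1ℚ t     ≡⟨ ≡.cong (λ s → ℚ.- (ĥ ℚ.* 1ℚ) ℚ.+ s ℚ.* ⟦ 𝐖₂ ⟧ ĥ 1ℚ t) l₂≡0 ⟨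
    ℚ.- (ĥ ℚ.* 1ℚ) ℚ.+ l₂ t ℚ.* ⟦ 𝐖₂ ⟧ ĥ 1ℚ t   ≡⟨ holds n³Q≋-hx³+l₂W₂ ĥ 1ℚ t ⟨
    ⟦ 𝐧 ^ᵉ 3 ⟧ ĥ 1ℚ t ℚ.* q t                  ≡⟨ x≡0⇒y*x≡0 (⟦ 𝐧 ^ᵉ 3 ⟧ ĥ 1ℚ t) q≡0 ⟩
    0ℚ                                        ∎))

  n̂⁻¹ t₁ t₂ : ℚ
  n̂⁻¹ = ℚ.1/_ n̂ {{ℚ.≢-nonZero n̂≢0}}
  t₁  = â ℚ.* n̂⁻¹
  t₂  = b̂ ℚ.* n̂⁻¹

  n̂n̂⁻¹≡1 : n̂ ℚ.* n̂⁻¹ ≡ 1ℚ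
  n̂n̂⁻¹≡1 = ℚ.*-inverseʳ n̂ {{ℚ.≢-nonZero n̂≢0}}

  l[u/n]≡0 : ∀ u → u ℚ.* 1ℚ ℚ.- n̂ ℚ.* (u ℚ.* n̂⁻¹) ≡ 0ℚ
  l[u/n]≡0 u = begin
    u ℚ.* 1ℚ ℚ.- n̂ ℚ.* (u ℚ.* n̂⁻¹)     ≡⟨ regroup u n̂ n̂⁻¹ ⟩
    u ℚ.- u ℚ.* (n̂ ℚ.* n̂⁻¹)            ≡⟨ ≡.cong (λ s → u ℚ.- u ℚ.* s) n̂n̂⁻¹≡1 ⟩
    u ℚ.- u ℚ.* 1ℚ                     ≡⟨ ≡.cong (ℚ._-_ u) (ℚ.*-identityʳ u) ⟩
    u ℚ.- u                            ≡⟨ ℚ.+-inverseʳ u ⟩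
    0ℚ                                 ∎
    where
    regroup : ∀ u n n⁻¹ → u ℚ.* 1ℚ ℚ.- n ℚ.* (u ℚ.* n⁻¹) ≡ u ℚ.- u ℚ.* (n ℚ.* n⁻¹)
    regroup = solve 3 (λ u n n⁻¹ → u :* con 1ℚ :- n :* (u :* n⁻¹) := u :- u :* (n :* n⁻¹)) ≡.refl

  roots-of-te : All (λ t → t ℚ.* e t ≡ 0ℚ) (0ℚ ∷ t₁ ∷ t₂ ∷ [])
  roots-of-te = x≡0⇒x*y≡0 (e 0ℚ) ≡.refl
              ∷ x≡0⇒y*x≡0 t₁ (x≡0⇒x*y≡0 (l₂ t₁) (l[u/n]≡0 â))
              ∷ x≡0⇒y*x≡0 t₂ (x≡0⇒y*x≡0 (l₁ t₂) (l[u/n]≡0 b̂))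
              ∷ []

  roots-of-te-distinct : Unique (0ℚ ∷ t₁ ∷ t₂ ∷ [])
  roots-of-te-distinct = (0≢t₁ ∷ 0≢t₂ ∷ []) ∷ (t₁≢t₂ ∷ []) ∷ [] ∷ []
    where
    n̂⁻¹≢0 : n̂⁻¹ ≢ 0ℚ
    n̂⁻¹≢0 n̂⁻¹≡0 = ℚ.1≢0 (≡.trans (≡.sym n̂n̂⁻¹≡1) (x≡0⇒y*x≡0 n̂ n̂⁻¹≡0))
    0≢t₁ : 0ℚ ≢ t₁
    0≢t₁ = *-≉0 â≢0 n̂⁻¹≢0 ∘ ≡.sym
    0≢t₂ : 0ℚ ≢ t₂
    0≢t₂ = *-≉0 (positive⇒≢0 𝐛 val-𝐛) n̂⁻¹≢0 ∘ ≡.sym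
    t₁≢t₂ : t₁ ≢ t₂
    t₁≢t₂ t₁≡t₂ = ℚ.1≢0 (begin
      1ℚ                     ≡⟨ ℚ.+-identityˡ 1ℚ ⟨
      0ℚ ℚ.+ 1ℚ              ≡⟨ ≡.cong (ℚ._+ 1ℚ) (l[u/n]≡0 â) ⟨
      l₁ t₁ ℚ.+ 1ℚ           ≡⟨ holds l₂≋l₁+x ĥ 1ℚ t₁ ⟨
      l₂ t₁                  ≡⟨ ≡.cong l₂ t₁≡t₂ ⟩
      l₂ t₂                  ≡⟨ l[u/n]≡0 b̂ ⟩
      0ℚ                     ∎)

  -- −1 is written ι(−1) so that l₁[1:-1]≋a+n and l₂[1:-1]≋b+n apply to it definitionally.
  -1·e[-1]≢0 : ι ℚ-field -[1+ 0 ] ℚ.* e (ι ℚ-field -[1+ 0 ]) ≢ 0ℚ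
  -1·e[-1]≢0 = *-≉0 (ι-ℚ-≢0 { -[1+ 0 ]} (λ ()))
    (*-≉0 (≡.subst (_≢ 0ℚ) (≡.sym (holds l₁[1:-1]≋a+n ĥ 0ℚ 0ℚ))
                   (positive⇒≢0 (𝐚 ⊕ 𝐧) (≡.cong₂ ℤ._+_ val-𝐚 val-𝐧)))
          (≡.subst (_≢ 0ℚ) (≡.sym (holds l₂[1:-1]≋b+n ĥ 0ℚ 0ℚ))
                   (positive⇒≢0 (𝐛 ⊕ 𝐧) (≡.cong₂ ℤ._+_ val-𝐛 val-𝐧))))

  module CommonFactor (h₀ : ℚ) (H₀ : List ℚ) (f₀ : ℚ) (F₀ : List ℚ) (g₀ : ℚ) (G₀ : List ℚ)
                      (F≡HF′ : toℚList F ≡ mulL (h₀ ∷ H₀) (f₀ ∷ F₀))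
                      (G≡HG′ : toℚList G ≡ mulL (h₀ ∷ H₀) (g₀ ∷ G₀)) where
    H F′ G′ : List ℚ
    H  = h₀ ∷ H₀
    F′ = f₀ ∷ F₀
    G′ = g₀ ∷ G₀

    η : ℚ → ℚ
    η = eval H

    module _ (𝔸 : Vec (List ℤ) 5) (k : ℚ) (K : List ℚ)
             (A≡HK : toℚList (Vec.map (val ∘ inH) 𝔸) ≡ mulL H (k ∷ K)) where
      form≡η·cofactor : ∀ t → ⟦ formL 𝔸 𝐱 𝐲 ⟧ ĥ 1ℚ t ≡ η t ℚ.* eval (k ∷ K) t
      form≡η·cofactor t = ≡.trans (≡.sym (eval-coefficients 𝔸 t))
                            (≡.trans (≡.cong (λ L → eval L t) A≡HK) (eval-mulL H (k ∷ K) t))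

      |H₀|+|cofactor|≡4 : length H₀ ℕ.+ length K ≡ 4
      |H₀|+|cofactor|≡4 = ℕ.suc-injective (begin
        ℕ.suc (length H₀ ℕ.+ length K)                ≡⟨ length-mulL h₀ H₀ k K ⟨
        length (mulL H (k ∷ K))                       ≡⟨ ≡.cong length A≡HK ⟨
        length (toℚList (Vec.map (val ∘ inH) 𝔸))       ≡⟨ length-toℚList (Vec.map (val ∘ inH) 𝔸) ⟩
        5                                             ∎)

      lastH·lastCofactor : lastCoeff H ℚ.* lastCoeff (k ∷ K) ≡ ⟦ inH (Vec.last 𝔸) ⟧ ĥ 0ℚ 0ℚ
      lastH·lastCofactor = ≡.trans (≡.sym (lastCoeff-mulL h₀ H₀ k K))
                             (≡.trans (≡.cong lastCoeff (≡.sym A≡HK)) (lastCoeff-coefficients 𝔸))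

    |F₀|≡|G₀| : length F₀ ≡ length G₀
    |F₀|≡|G₀| = ℕ.+-cancelˡ-≡ (length H₀) (length F₀) (length G₀)
                  (≡.trans (|H₀|+|cofactor|≡4 𝔽 f₀ F₀ F≡HF′) (≡.sym (|H₀|+|cofactor|≡4 𝔾 g₀ G₀ G≡HG′)))

    lastH·lastF′≡ĥn̂ : lastCoeff H ℚ.* lastCoeff F′ ≡ ĥ ℚ.* n̂
    lastH·lastF′≡ĥn̂ = ≡.trans (lastH·lastCofactor 𝔽 f₀ F₀ F≡HF′) (holds F₄≋hn ĥ 0ℚ 0ℚ)

    lastH·lastG′≡ĥâ : lastCoeff H ℚ.* lastCoeff G′ ≡ ĥ ℚ.* â
    lastH·lastG′≡ĥâ = ≡.trans (lastH·lastCofactor 𝔾 g₀ G₀ G≡HG′) (holds G₄≋ha ĥ 0ℚ 0ℚ)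

    lastH≢0 : lastCoeff H ≢ 0ℚ
    lastH≢0 lastH≡0 = *-≉0 ĥ≢0 â≢0 (≡.trans (≡.sym lastH·lastG′≡ĥâ) (x≡0⇒x*y≡0 (lastCoeff G′) lastH≡0))

    private
      distribute : ∀ η u w p p′ → η ℚ.* (u ℚ.* p ℚ.+ w ℚ.* p′) ≡ u ℚ.* (η ℚ.* p) ℚ.+ w ℚ.* (η ℚ.* p′)
      distribute = solve 5 (λ η u w p p′ → η :* (u :* p :+ w :* p′) := u :* (η :* p) :+ w :* (η :* p′))
                           ≡.refl

    pencil : ℚ → ℚ → List ℚ
    pencil u w = addL (List.map (u ℚ.*_) F′) (List.map (w ℚ.*_) G′)

    η·pencil : ∀ u w t → η t ℚ.* eval (pencil u w) t ≡ u ℚ.* f t ℚ.+ w ℚ.* g t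
    η·pencil u w t = begin
      η t ℚ.* eval (pencil u w) t
        ≡⟨ ≡.cong (η t ℚ.*_) (≡.trans (eval-addL (List.map (u ℚ.*_) F′) (List.map (w ℚ.*_) G′) t)
                                      (≡.cong₂ ℚ._+_ (eval-scale u F′ t) (eval-scale w G′ t))) ⟩
      η t ℚ.* (u ℚ.* eval F′ t ℚ.+ w ℚ.* eval G′ t)
        ≡⟨ distribute (η t) u w (eval F′ t) (eval G′ t) ⟩
      u ℚ.* (η t ℚ.* eval F′ t) ℚ.+ w ℚ.* (η t ℚ.* eval G′ t)
        ≡⟨ ≡.cong₂ (λ p p′ → u ℚ.* p ℚ.+ w ℚ.* p′)
             (form≡η·cofactor 𝔽 f₀ F₀ F≡HF′ t) (form≡η·cofactor 𝔾 g₀ G₀ G≡HG′ t) ⟨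
      u ℚ.* f t ℚ.+ w ℚ.* g t ∎

    |pencil| : ∀ u w → length (pencil u w) ≡ ℕ.suc (length F₀)
    |pencil| u w = begin
      length (pencil u w)
        ≡⟨ length-addL (List.map (u ℚ.*_) F′) (List.map (w ℚ.*_) G′) ⟩
      length (List.map (u ℚ.*_) F′) ℕ.⊔ length (List.map (w ℚ.*_) G′)
        ≡⟨ ≡.cong₂ ℕ._⊔_ (Listₚ.length-map (u ℚ.*_) F′)
             (≡.trans (Listₚ.length-map (w ℚ.*_) G′) (≡.cong ℕ.suc (≡.sym |F₀|≡|G₀|))) ⟩
      ℕ.suc (length F₀) ℕ.⊔ ℕ.suc (length F₀)
        ≡⟨ ℕ.⊔-idem _ ⟩
      ℕ.suc (length F₀) ∎

    lastH·lastPencil : ∀ u w →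
                       lastCoeff H ℚ.* lastCoeff (pencil u w) ≡ u ℚ.* (ĥ ℚ.* n̂) ℚ.+ w ℚ.* (ĥ ℚ.* â)
    lastH·lastPencil u w = begin
      lastCoeff H ℚ.* lastCoeff (pencil u w)
        ≡⟨ ≡.cong (lastCoeff H ℚ.*_) (≡.trans (lastCoeff-addL-≡ (List.map (u ℚ.*_) F′) _ |uF′|≡|wG′|)
                                              (≡.cong₂ ℚ._+_ (lastCoeff-scale u F′) (lastCoeff-scale w G′))) ⟩
      lastCoeff H ℚ.* (u ℚ.* lastCoeff F′ ℚ.+ w ℚ.* lastCoeff G′)
        ≡⟨ distribute (lastCoeff H) u w (lastCoeff F′) (lastCoeff G′) ⟩
      u ℚ.* (lastCoeff H ℚ.* lastCoeff F′) ℚ.+ w ℚ.* (lastCoeff H ℚ.* lastCoeff G′)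
        ≡⟨ ≡.cong₂ (λ p p′ → u ℚ.* p ℚ.+ w ℚ.* p′) lastH·lastF′≡ĥn̂ lastH·lastG′≡ĥâ ⟩
      u ℚ.* (ĥ ℚ.* n̂) ℚ.+ w ℚ.* (ĥ ℚ.* â) ∎
      where
      |uF′|≡|wG′| : length (List.map (u ℚ.*_) F′) ≡ length (List.map (w ℚ.*_) G′)
      |uF′|≡|wG′| = ≡.trans (Listₚ.length-map (u ℚ.*_) F′)
                      (≡.trans (≡.cong ℕ.suc |F₀|≡|G₀|) (≡.sym (Listₚ.length-map (w ℚ.*_) G′)))

    A B : List ℚ
    A = pencil â (ℚ.- n̂)
    B = pencil 1ℚ (ℚ.- b̂)

    η·A≡q : ∀ t → η t ℚ.* eval A t ≡ q t
    η·A≡q t = ≡.trans (η·pencil â (ℚ.- n̂) t)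
                (≡.trans (≡.cong (â ℚ.* f t ℚ.+_) (≡.sym (ℚ.neg-distribˡ-* n̂ (g t)))) (af-ng≡q t))

    η·B≡t[q+e] : ∀ t → η t ℚ.* eval B t ≡ t ℚ.* (q t ℚ.+ e t)
    η·B≡t[q+e] t = ≡.trans (η·pencil 1ℚ (ℚ.- b̂) t)
                     (≡.trans (≡.cong₂ ℚ._+_ (ℚ.*-identityˡ (f t)) (≡.sym (ℚ.neg-distribˡ-* b̂ (g t))))
                              (f-bg≡t[q+e] t))

    lastA≡0 : lastCoeff A ≡ 0ℚ
    lastA≡0 = x*y≈0⇒y≈0 lastH≢0 (≡.trans (lastH·lastPencil â (ℚ.- n̂)) (cancel â n̂ ĥ))
      where
      cancel : ∀ a n h → a ℚ.* (h ℚ.* n) ℚ.+ ℚ.- n ℚ.* (h ℚ.* a) ≡ 0ℚ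
      cancel = solve 3 (λ a n h → a :* (h :* n) :+ :- n :* (h :* a) := con 0ℚ) ≡.refl

    A′ : List ℚ
    A′ = proj₁ (dropLastZero A lastA≡0)

    η·A′≡q : ∀ t → η t ℚ.* eval A′ t ≡ q t
    η·A′≡q t = ≡.trans (≡.cong (η t ℚ.*_) (proj₂ (proj₂ (dropLastZero A lastA≡0)) t)) (η·A≡q t)

    C : List ℚ
    C = addL B (0ℚ ∷ List.map (ℚ.- 1ℚ ℚ.*_) A′)

    |C| : length C ≡ ℕ.suc (length F₀)
    |C| = begin
      length C                                                ≡⟨ length-addL B (0ℚ ∷ List.map (ℚ.- 1ℚ ℚ.*_) A′) ⟩
      length B ℕ.⊔ ℕ.suc (length (List.map (ℚ.- 1ℚ ℚ.*_) A′))  ≡⟨ ≡.cong₂ ℕ._⊔_ (|pencil| 1ℚ (ℚ.- b̂)) (≡.cong ℕ.suc |-A′|) ⟩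
      ℕ.suc (length F₀) ℕ.⊔ ℕ.suc (length F₀)                   ≡⟨ ℕ.⊔-idem _ ⟩
      ℕ.suc (length F₀)                                        ∎
      where
      |-A′| : length (List.map (ℚ.- 1ℚ ℚ.*_) A′) ≡ length F₀
      |-A′| = ≡.trans (Listₚ.length-map (ℚ.- 1ℚ ℚ.*_) A′)
                (≡.trans (proj₁ (proj₂ (dropLastZero A lastA≡0))) (≡.cong ℕ.pred (|pencil| â (ℚ.- n̂))))

    η·C≡te : ∀ t → η t ℚ.* eval C t ≡ t ℚ.* e t
    η·C≡te t = begin
      η t ℚ.* eval C t
        ≡⟨ ≡.cong (η t ℚ.*_) (≡.trans (eval-addL B (0ℚ ∷ List.map (ℚ.- 1ℚ ℚ.*_) A′) t)
             (≡.cong (λ s → eval B t ℚ.+ (0ℚ ℚ.+ t ℚ.* s)) (eval-scale (ℚ.- 1ℚ) A′ t))) ⟩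
      η t ℚ.* (eval B t ℚ.+ (0ℚ ℚ.+ t ℚ.* (ℚ.- 1ℚ ℚ.* eval A′ t)))
        ≡⟨ regroup₁ (η t) (eval B t) t (eval A′ t) ⟩
      η t ℚ.* eval B t ℚ.- t ℚ.* (η t ℚ.* eval A′ t)
        ≡⟨ ≡.cong₂ (λ p p′ → p ℚ.- t ℚ.* p′) (η·B≡t[q+e] t) (η·A′≡q t) ⟩
      t ℚ.* (q t ℚ.+ e t) ℚ.- t ℚ.* q t
        ≡⟨ regroup₂ t (q t) (e t) ⟩
      t ℚ.* e t ∎
      where
      regroup₁ : ∀ η b t a → η ℚ.* (b ℚ.+ (0ℚ ℚ.+ t ℚ.* (ℚ.- 1ℚ ℚ.* a))) ≡ η ℚ.* b ℚ.- t ℚ.* (η ℚ.* a)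
      regroup₁ = solve 4 (λ η b t a → η :* (b :+ (con 0ℚ :+ t :* (con (ℚ.- 1ℚ) :* a)))
                                      := η :* b :- t :* (η :* a)) ≡.refl
      regroup₂ : ∀ t q e → t ℚ.* (q ℚ.+ e) ℚ.- t ℚ.* q ≡ t ℚ.* e
      regroup₂ = solve 3 (λ t q e → t :* (q :+ e) :- t :* q := t :* e) ≡.refl

    η-rootless : ∀ r → η r ≢ 0ℚ
    η-rootless r ηr≡0 = q≢0 r (≡.trans (≡.sym (η·C≡te r)) (x≡0⇒x*y≡0 (eval C r) ηr≡0))
                              (≡.trans (≡.sym (η·A′≡q r)) (x≡0⇒x*y≡0 (eval A′ r) ηr≡0))

    cofactor-degree≤2⇒⊥ : length F₀ ℕ.≤ 2 → ⊥
    cofactor-degree≤2⇒⊥ |F₀|≤2 = -1·e[-1]≢0 (begin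
      t₋₁ ℚ.* e t₋₁             ≡⟨ η·C≡te t₋₁ ⟨
      η t₋₁ ℚ.* eval C t₋₁      ≡⟨ x≡0⇒y*x≡0 (η t₋₁) (C≡0 t₋₁) ⟩
      0ℚ                       ∎)
      where
      t₋₁ : ℚ
      t₋₁ = ι ℚ-field -[1+ 0 ]
      C≡0 : ∀ t → eval C t ≡ 0ℚ
      C≡0 = vanishes C (0ℚ ∷ t₁ ∷ t₂ ∷ []) roots-of-te-distinct
              (≡.subst (ℕ._≤ 3) (≡.sym |C|) (ℕ.s≤s |F₀|≤2))
              (All.map (λ {t} te≡0 → x*y≈0⇒y≈0 (η-rootless t) (≡.trans (η·C≡te t) te≡0)) roots-of-te)

  noCommonFactor : NoCommonFactor F G
  noCommonFactor ([]               , _       , _       , ()       , _     , _)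
  noCommonFactor ((_ ∷ [])         , _       , _       , ℕ.s≤s () , _     , _)
  noCommonFactor (H@(_ ∷ _ ∷ _)    , []      , _       , _        , F≡H[] , _) =
    *-≉0 ĥ≢0 n̂≢0 (≡.trans (≡.sym lastCoeff-F) (≡.trans (≡.cong lastCoeff F≡H[]) (lastCoeff-mulL-[] H)))
  noCommonFactor (H@(_ ∷ _ ∷ _)    , _ ∷ _   , []      , _        , _     , G≡H[]) =
    *-≉0 ĥ≢0 â≢0 (≡.trans (≡.sym lastCoeff-G) (≡.trans (≡.cong lastCoeff G≡H[]) (lastCoeff-mulL-[] H)))
  noCommonFactor ((α ∷ β ∷ [])     , f₀ ∷ F₀ , g₀ ∷ G₀ , _        , F≡HF′ , G≡HG′) =
    η-rootless (proj₁ (linear-root α β lastH≢0)) (proj₂ (linear-root α β lastH≢0))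
    where open CommonFactor α (β ∷ []) f₀ F₀ g₀ G₀ F≡HF′ G≡HG′
  noCommonFactor ((α ∷ β ∷ γ ∷ H₁) , f₀ ∷ F₀ , g₀ ∷ G₀ , _        , F≡HF′ , G≡HG′) =
    cofactor-degree≤2⇒⊥ (≡.subst (length F₀ ℕ.≤_) (ℕ.suc-injective (ℕ.suc-injective |H₀|+|F₀|≡4))
                                 (ℕ.m≤n+m (length F₀) (length H₁)))
    where
    open CommonFactor α (β ∷ γ ∷ H₁) f₀ F₀ g₀ G₀ F≡HF′ G≡HG′
    |H₀|+|F₀|≡4 : length (β ∷ γ ∷ H₁) ℕ.+ length F₀ ≡ 4
    |H₀|+|F₀|≡4 = |H₀|+|cofactor|≡4 𝔽 f₀ F₀ F≡HF′

theorem2 : ∀ (N : ℕ) → Σ ℕ λ n → N < n × ¬ (2 ∣ n) ×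
    Σ RatMap4 λ Φ → IsDegree4 Φ × GoodReductionOutside2 Φ ×
      Σ Point λ P₀ → Σ Point λ P₁ → Σ Point λ P₂ →
        IsThreeCycle Φ P₀ P₁ P₂ × IdealIs n P₀ P₁
theorem2 N = n , N<n , n-odd , Φ , noCommonFactor , goodReductionOutside2 , P₀ , P₁ , P₂ , threeCycle , ideal
  where
  open Construction (ℕ.pred (2 ℕ.^ N))
  open Coprimality (ℕ.pred (2 ℕ.^ N)) using (noCommonFactor)

  h≡2^N : h ≡ 2 ℕ.^ N
  h≡2^N = ℕ.suc-pred (2 ℕ.^ N) {{ℕ.m^n≢0 2 N}}

  N<n : N < n
  N<n = ℕ.<-trans (≡.subst (N <_) (≡.sym h≡2^N) (n<2^n N)) h<n

  goodReductionOutside2 : GoodReductionOutside2 Φ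
  goodReductionOutside2 p p-prime p≢2 =
    goodReduction p p-prime (p≢2 ∘ prime∣2^k⇒≡2 N p-prime ∘ ≡.subst (p ∣_) h≡2^N)
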